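{- Let $\zeta\in\mathcal T$ be regular and dominant (i.e. $\langle\zeta,\alpha_i\rangle>0$ for $i=0,\dots,n$), and let $x=X^{\tilde v\zeta}\tilde w$ with $\tilde v,\tilde w\in W_{\mathrm{aff}}$. Then $$\ell(x)=\ell(X^\zeta)-\ell(\tilde v^{ -1}\tilde w)+\ell(\tilde v)=\langle\zeta,2\rho\rangle-\ell(\tilde w^{ -1}\tilde v)+\ell(\tilde v).$$
   Context: Let $\Phi_{\mathrm{fin}}$ be an irreducible simply laced finite root system with simple roots $\alpha_1,\dots,\alpha_n$, highest root $\theta$, Weyl group $W_{\mathrm{fin}}$, root lattice $Q$, weight lattice $P$, and $W_{\mathrm{fin}}$-invariant pairing $\langle\,,\rangle$ with $\langle\nu,\nu\rangle=2$ for roots $\nu$. Affine roots are $\nu+r\delta$ ($\nu\in\Phi_{\mathrm{fin}}, r\in\mathbb{Z}$); $\nu+r\delta>0$ iff $r>0$, or $r=0$ and $\nu>0$. Affine simple roots: $\alpha_0=-\theta+\delta,\alpha_1,\dots,\alpha_n$. $X=P\oplus\mathbb{Z}\delta\oplus\mathbb{Z}\Lambda_0$, level of $\mu+m\delta+l\Lambda_0$ is $l$; $\langle \mu+m\delta+l\Lambda_0,\nu+r\delta\rangle=\langle\mu,\nu\rangle+lr$. $W_{\mathrm{aff}}=\{Y^\lambda w:\lambda\in Q,w\in W_{\mathrm{fin}}\}$ is the affine Weyl group with Coxeter length $\ell$ and inversion sets $\mathrm{Inv}(\tilde w)=\{\beta>0:\tilde w(\beta)<0\}$, acting on $X$ by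 $Y^\lambda w(\mu+m\delta+l\Lambda_0)=w(\mu)+l\lambda+(m-\langle w(\mu),\lambda\rangle-l\langle\lambda,\lambda\rangle/2)\delta+l\Lambda_0$ and on affine roots by $Y^\lambda w(\nu+r\delta)=w(\nu)+(r-\langle\lambda,w(\nu)\rangle)\delta$. $\zeta$ dominant means $\langle\zeta,\alpha_i\rangle\ge 0$ for $i=0,\dots,n$. Tits cone $\mathcal T=\{m\delta\}\cup\{\text{elements of positive level}\}$; $W=\{X^\zeta\tilde w:\zeta\in\mathcal T,\tilde w\in W_{\mathrm{aff}}\}$. Fix a linear functional $\langle\cdot,\rho\rangle$ on $X$ with $\langle\alpha_i,\rho\rangle=1$ for all $i=0,\dots,n$; $\langle\cdot,2\rho\rangle=2\langle\cdot,\rho\rangle$. Length on $W$: $\ell(X^\zeta\tilde w)=\langle\zeta_+,2\rho\rangle+|\{\beta\in\mathrm{Inv}(\tilde w^{ -1}):\langle\zeta,\beta\rangle\le0\}|-|\{\beta\in\mathrm{Inv}(\tilde w^{ -1}):\langle\zeta,\beta\rangle>0\}|$, with $\zeta_+$ the dominant element of the $W_{\mathrm{aff}}$-orbit of $\zeta$; $\ell(X^\zeta)$ means $\ell(X^\zeta\cdot 1)$. -}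

module Defs where

open import Data.Nat as ℕ using (ℕ; zero; suc)
open import Data.Integer as ℤ using (ℤ; +_; 0ℤ; 1ℤ; -_; _+_; _*_; _-_)
open import Data.Fin using (Fin; zero; suc)
open import Data.Vec as V using (Vec; lookup; tabulate; zipWith; replicate)
open import Data.List as L using (List; length; reverse; _++_)
open import Data.List.Membership.Propositional using (_∈_)
open import Data.List.Relation.Unary.Unique.Propositional using (Unique)
open import Data.Product using (Σ; ∃; ∃₂; _×_; _,_; proj₁; proj₂)
open import Data.Sum using (_⊎_)
open import Data.Bool using (Bool; true; false)
open import Relation.Binary.PropositionalEquality using (_≡_; _≢_)
open import Data.Rational as ℚ using (ℚ)

Σᶠ : ∀ {n} → (Fin n → ℤ) → ℤ
Σᶠ {zero}  f = 0ℤ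
Σᶠ {suc n} f = f zero + Σᶠ (λ i → f (suc i))

form : ∀ {n} → (Fin n → Fin n → ℤ) → Vec ℤ n → Vec ℤ n → ℤ
form A v w = Σᶠ (λ i → Σᶠ (λ j → lookup v i * A i j * lookup w j))

-- An irreducible simply laced finite root system, given by its Cartan
-- matrix  A i j = ⟨α_i , α_j⟩  (symmetric, 2 on the diagonal, 0/-1 off
-- the diagonal, positive definite, connected Dynkin diagram, rank ≥ 1).

record SLCartan : Set where
  field
    n         : ℕ
    A         : Fin n → Fin n → ℤ
    rank-pos  : 1 ℕ.≤ n
    diag      : ∀ i → A i i ≡ + 2
    symm      : ∀ i j → A i j ≡ A j i
    offdiag   : ∀ i j → i ≢ j → (A i j ≡ 0ℤ) ⊎ (A i j ≡ - 1ℤ)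
    posdef    : ∀ (v : Vec ℤ n) → v ≢ replicate n 0ℤ → 0ℤ ℤ.< form A v v
    connected : ∀ (S : Fin n → Bool) → (∃ λ i → S i ≡ true) → (∃ λ j → S j ≡ false) →
                ∃₂ λ i j → S i ≡ true × S j ≡ false × A i j ≢ 0ℤ

-- Everything below depends on the Cartan matrix and on a vector θ
-- (in root coordinates) which will be assumed to be the highest root.

module Affine (C : SLCartan) (θ : Vec ℤ (SLCartan.n C)) where
  open SLCartan C

  -- Root lattice Q: coordinates w.r.t. the simple roots α_1..α_n.
  Q : Set
  Q = Vec ℤ n

  -- Weight lattice P: coordinates w.r.t. the fundamental weights
  -- (Dynkin labels  μ_i = ⟨μ , α_i⟩ ).
  P : Set
  P = Vec ℤ n

  e : Fin n → Q
  e i = tabulate (λ j → Data.Bool.if isEq i j then 1ℤ else 0ℤ)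
    where
      open import Data.Fin using (_≟_)
      open import Relation.Nullary.Decidable using (⌊_⌋)
      isEq : Fin n → Fin n → Bool
      isEq i j = ⌊ i ≟ j ⌋

  _+Q_ : Q → Q → Q
  _+Q_ = zipWith _+_

  _·Q_ : ℤ → Q → Q
  c ·Q v = V.map (c *_) v

  -Q_ : Q → Q
  -Q v = V.map -_ v

  pairQQ : Q → Q → ℤ
  pairQQ = form A

  pairQP : Q → P → ℤ
  pairQP ν μ = Σᶠ (λ i → lookup ν i * lookup μ i)

  toP : Q → P
  toP ν = tabulate (λ j → Σᶠ (λ i → lookup ν i * A i j))

  sQ : Fin n → Q → Q
  sQ i ν = ν +Q ((- pairQQ ν (e i)) ·Q e i)

  actFin : List (Fin n) → Q → Q
  actFin w ν = L.foldr sQ ν w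

  IsRoot : Q → Set
  IsRoot ν = ∃₂ λ (w : List (Fin n)) (i : Fin n) → actFin w (e i) ≡ ν

  PosQ : Q → Set
  PosQ ν = ∀ k → 0ℤ ℤ.≤ lookup ν k

  IsHighestRoot : Q → Set
  IsHighestRoot t = IsRoot t × (∀ ν → IsRoot ν → PosQ (t +Q (-Q ν)))

  -- X = P ⊕ ℤδ ⊕ ℤΛ₀ ,  element  μ + m δ + l Λ₀

  record X : Set where
    constructor mkX
    field
      μ : P
      m : ℤ
      l : ℤ
  open X public

  _+X_ : X → X → X
  mkX μ m l +X mkX μ' m' l' = mkX (zipWith _+_ μ μ') (m + m') (l + l')

  _·X_ : ℤ → X → X
  c ·X mkX μ m l = mkX (V.map (c *_) μ) (c * m) (c * l)

  level : X → ℤ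
  level = l

  -- affine roots ν + r δ, stored as (ν , r)
  AR : Set
  AR = Q × ℤ

  IsAffRoot : AR → Set
  IsAffRoot (ν , r) = IsRoot ν

  PosAR : AR → Set
  PosAR (ν , r) = (0ℤ ℤ.< r) ⊎ (r ≡ 0ℤ × PosQ ν)

  NegAR : AR → Set
  NegAR (ν , r) = PosAR (-Q ν , - r)

  αA : Fin (suc n) → AR
  αA zero    = (-Q θ , 1ℤ)
  αA (suc i) = (e i , 0ℤ)

  αX : Fin (suc n) → X
  αX zero    = mkX (toP (-Q θ)) 1ℤ 0ℤ
  αX (suc i) = mkX (toP (e i)) 0ℤ 0ℤ

  pairXA : X → AR → ℤ
  pairXA (mkX μ m l) (ν , r) = pairQP ν μ + l * r

  pairAA : AR → AR → ℤ
  pairAA (ν , r) (ν' , r') = pairQQ ν ν'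

  _+A_ : AR → AR → AR
  (ν , r) +A (ν' , r') = (ν +Q ν' , r + r')

  _·A_ : ℤ → AR → AR
  c ·A (ν , r) = (c ·Q ν , c * r)

  sX : Fin (suc n) → X → X
  sX i x = x +X ((- pairXA x (αA i)) ·X αX i)

  sA : Fin (suc n) → AR → AR
  sA i β = β +A ((- pairAA β (αA i)) ·A αA i)

  -- elements of W_aff as words in s_0..s_n ;  s_{i1} ⋯ s_{ik}
  Word : Set
  Word = List (Fin (suc n))

  actX : Word → X → X
  actX w x = L.foldr sX x w

  actA : Word → AR → AR
  actA w β = L.foldr sA β w

  -- inverse of an element (each s_i is an involution)
  inv : Word → Word
  inv = reverse

  -- equality of elements of W_aff (as transformations of X)
  _≈W_ : Word → Word → Set
  u ≈W v = ∀ x → actX u x ≡ actX v x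

  CoxLen : Word → ℕ → Set
  CoxLen w k = (∃ λ u → length u ≡ k × u ≈W w) × (∀ u → u ≈W w → k ℕ.≤ length u)

  Inv : Word → AR → Set
  Inv w β = IsAffRoot β × PosAR β × NegAR (actA w β)

  Card : (AR → Set) → ℕ → Set
  Card S k = Σ (List AR) λ xs → length xs ≡ k × Unique xs ×
             (∀ β → (β ∈ xs → S β) × (S β → β ∈ xs))

  Dominant : X → Set
  Dominant ζ = ∀ i → 0ℤ ℤ.≤ pairXA ζ (αA i)

  Regular : X → Set
  Regular ζ = ∀ i → 0ℤ ℤ.< pairXA ζ (αA i)

  δX : X
  δX = mkX (replicate n 0ℤ) 1ℤ 0ℤ

  InTits : X → Set
  InTits ζ = (∃ λ m → ζ ≡ m ·X δX) ⊎ (0ℤ ℤ.< level ζ)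

  -- linear functionals ⟨· , ρ⟩ : X → ℚ with ⟨α_i , ρ⟩ = 1 (i = 0..n)
  IsRho : (X → ℚ) → Set
  IsRho f = (∀ x y → f (x +X y) ≡ f x ℚ.+ f y) × (∀ i → f (αX i) ≡ ℚ.1ℚ)

  ℕtoℚ : ℕ → ℚ
  ℕtoℚ k = (+ k) ℚ./ 1

  two : ℚ
  two = (+ 2) ℚ./ 1

  -- length on W :  ℓ(X^ζ w̃) = L , with ⟨·,ρ⟩ = f
  LenW : (X → ℚ) → X → Word → ℚ → Set
  LenW f ζ w L =
    Σ X λ ζ₊ → Dominant ζ₊ × (∃ λ u → actX u ζ ≡ ζ₊) ×
    ∃₂ λ a b →
      Card (λ β → Inv (inv w) β × pairXA ζ β ℤ.≤ 0ℤ) a ×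
      Card (λ β → Inv (inv w) β × 0ℤ ℤ.< pairXA ζ β) b ×
      L ≡ (two ℚ.* f ζ₊) ℚ.+ ℕtoℚ a ℚ.- ℕtoℚ b

module Submission where

-- For regular dominant ζ the sign of ⟨vζ, β⟩ = ⟨ζ, v⁻¹β⟩ is the sign of the affine
-- root v⁻¹β, and ζ is the only dominant element of its orbit.  Hence ℓ(X^{vζ} w) = ⟨ζ, 2ρ⟩ + |A| − |B|,
-- where A and B are the inversions β of w⁻¹ with v⁻¹β negative, resp. positive.  Splitting Inv(v⁻¹)
-- by the sign of w⁻¹β and Inv(w⁻¹v) by the sign of vγ, A and (a copy of) B appear as parts, and the
-- two remaining parts are matched by γ ↦ −vγ; so |A| − |B| = ℓ(v) − ℓ(w⁻¹v).  This uses that the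
-- Coxeter length of a word is its number of inversions: counting inversions letter by letter gives
-- |Inv(u s_i)| = |Inv u| ± 1, and the deletion condition shows that this count is attained.

open import Data.Nat as ℕ using (ℕ; zero; suc)
import Data.Nat.Properties as ℕP
open import Algebra.Properties.CommutativeSemigroup ℕP.+-commutativeSemigroup using (x∙yz≈y∙xz)
open import Data.Integer as ℤ using (ℤ; +_; 0ℤ; 1ℤ)
import Data.Integer.Properties as ℤP
open import Data.Integer.Tactic.RingSolver using (solve-∀)
open import Data.Fin as F using (Fin; zero; suc)
import Data.Fin.Properties as FP
open import Data.Vec as V using (Vec; lookup; tabulate; zipWith; replicate)
import Data.Vec.Properties as VP
open import Data.List as L using (List; []; _∷_; _++_; length; reverse; filter)
import Data.List.Properties as LP
open import Data.List.Reverse using (Reverse; []; _∶_∶ʳ_; reverseView)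
open import Data.List.Membership.Propositional using (_∈_)
open import Data.List.Membership.Propositional.Properties using (∈-map⁺; ∈-map⁻; ∈-filter⁺; ∈-filter⁻)
open import Data.List.Membership.Propositional.Properties.WithK using (unique∧set⇒bag)
open import Data.List.Relation.Unary.Any using (here; there)
open import Data.List.Relation.Unary.All as All using (All)
open import Data.List.Relation.Unary.Unique.Propositional using (Unique; []; _∷_)
import Data.List.Relation.Unary.Unique.Propositional.Properties as Uniq
open import Data.List.Relation.Binary.BagAndSetEquality using (∼bag⇒↭)
open import Data.List.Relation.Binary.Permutation.Propositional.Properties using (↭-length)
import Data.Product.Properties as ProdP
open import Data.Rational as ℚ using (ℚ)
import Data.Rational.Properties as ℚP
open import Data.Rational.Solver using (module +-*-Solver)
open import Data.Nat.Coprimality as Coprime using (1-coprimeTo)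
open import Data.Product using (Σ; ∃; _×_; _,_; proj₁; proj₂)
open import Data.Sum using (_⊎_; inj₁; inj₂)
open import Data.Empty using (⊥-elim)
open import Data.Bool using (true; false; if_then_else_)
open import Function using (_∘_)
open import Function.Bundles using (mk⇔)
open import Relation.Nullary using (¬_; Dec; yes; no)
open import Relation.Unary using (Decidable)
open import Relation.Unary.Properties using (∁?)
open import Relation.Binary.Definitions using (tri<; tri≈; tri>)
open import Relation.Binary.PropositionalEquality
open import Defs

module _ where
  open import Data.Integer using (-_; _+_; _*_; _≤_; _<_)

  Σᶠ-cong : ∀ {n} {f g : Fin n → ℤ} → (∀ i → f i ≡ g i) → Σᶠ f ≡ Σᶠ g
  Σᶠ-cong {zero}  p = refl
  Σᶠ-cong {suc n} p = cong₂ _+_ (p zero) (Σᶠ-cong (p ∘ suc))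

  Σᶠ-zero : ∀ {n} → Σᶠ {n} (λ _ → 0ℤ) ≡ 0ℤ
  Σᶠ-zero {zero}  = refl
  Σᶠ-zero {suc n} = trans (ℤP.+-identityˡ _) (Σᶠ-zero {n})

  Σᶠ-distrib-+ : ∀ {n} (f g : Fin n → ℤ) → Σᶠ (λ i → f i + g i) ≡ Σᶠ f + Σᶠ g
  Σᶠ-distrib-+ {zero}  f g = refl
  Σᶠ-distrib-+ {suc n} f g =
    trans (cong (λ s → f zero + g zero + s) (Σᶠ-distrib-+ (f ∘ suc) (g ∘ suc)))
          (interchange (f zero) (g zero) (Σᶠ (f ∘ suc)) (Σᶠ (g ∘ suc)))
    where interchange : ∀ a b c d → a + b + (c + d) ≡ a + c + (b + d)
          interchange = solve-∀

  Σᶠ-distribˡ-* : ∀ {n} (c : ℤ) (f : Fin n → ℤ) → Σᶠ (λ i → c * f i) ≡ c * Σᶠ f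
  Σᶠ-distribˡ-* {zero}  c f = sym (ℤP.*-zeroʳ c)
  Σᶠ-distribˡ-* {suc n} c f =
    trans (cong (λ s → c * f zero + s) (Σᶠ-distribˡ-* c (f ∘ suc))) (sym (ℤP.*-distribˡ-+ c (f zero) _))

  Σᶠ-neg : ∀ {n} (f : Fin n → ℤ) → Σᶠ (λ i → - f i) ≡ - Σᶠ f
  Σᶠ-neg f = trans (Σᶠ-cong (λ i → sym (ℤP.-1*i≡-i (f i))))
                   (trans (Σᶠ-distribˡ-* (- 1ℤ) f) (ℤP.-1*i≡-i _))

  Σᶠ-swap : ∀ {n m} (f : Fin n → Fin m → ℤ) →
            Σᶠ (λ i → Σᶠ (λ j → f i j)) ≡ Σᶠ (λ j → Σᶠ (λ i → f i j))
  Σᶠ-swap {zero}  {m} f = sym (Σᶠ-zero {m})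
  Σᶠ-swap {suc n} {m} f =
    trans (cong (λ s → Σᶠ (f zero) + s) (Σᶠ-swap (f ∘ suc)))
          (sym (Σᶠ-distrib-+ (f zero) (λ j → Σᶠ (λ i → f (suc i) j))))

  Σᶠ-single : ∀ {n} (f : Fin n → ℤ) (k : Fin n) → (∀ j → j ≢ k → f j ≡ 0ℤ) → Σᶠ f ≡ f k
  Σᶠ-single {suc n} f zero    h =
    trans (cong (λ s → f zero + s) (trans (Σᶠ-cong (λ j → h (suc j) λ ())) (Σᶠ-zero {n}))) (ℤP.+-identityʳ _)
  Σᶠ-single {suc n} f (suc k) h =
    trans (cong (_+ Σᶠ (f ∘ suc)) (h zero λ ())) (trans (ℤP.+-identityˡ _)
          (Σᶠ-single (f ∘ suc) k (λ j j≢k → h (suc j) (j≢k ∘ FP.suc-injective))))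

  Σᶠ-nonneg : ∀ {n} (f : Fin n → ℤ) → (∀ i → 0ℤ ≤ f i) → 0ℤ ≤ Σᶠ f
  Σᶠ-nonneg {zero}  f h = ℤP.≤-refl
  Σᶠ-nonneg {suc n} f h = ℤP.+-mono-≤ (h zero) (Σᶠ-nonneg (f ∘ suc) (h ∘ suc))

  Σᶠ-nonpos : ∀ {n} (f : Fin n → ℤ) → (∀ i → f i ≤ 0ℤ) → Σᶠ f ≤ 0ℤ
  Σᶠ-nonpos {zero}  f h = ℤP.≤-refl
  Σᶠ-nonpos {suc n} f h = ℤP.+-mono-≤ (h zero) (Σᶠ-nonpos (f ∘ suc) (h ∘ suc))

  Σᶠ-pos : ∀ {n} (f : Fin n → ℤ) → (∀ i → 0ℤ ≤ f i) → (k : Fin n) → 0ℤ < f k → 0ℤ < Σᶠ f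
  Σᶠ-pos {suc n} f h zero    p = ℤP.+-mono-<-≤ p (Σᶠ-nonneg (f ∘ suc) (h ∘ suc))
  Σᶠ-pos {suc n} f h (suc k) p = ℤP.+-mono-≤-< (h zero) (Σᶠ-pos (f ∘ suc) (h ∘ suc) k p)

  *-nonneg : ∀ {a b : ℤ} → 0ℤ ≤ a → 0ℤ ≤ b → 0ℤ ≤ a * b
  *-nonneg {+ x} {+ y} _ _ = subst (0ℤ ≤_) (ℤP.pos-* x y) (ℤ.+≤+ ℕ.z≤n)

  *-pos : ∀ {a b : ℤ} → 0ℤ < a → 0ℤ < b → 0ℤ < a * b
  *-pos {+ suc m} {+ suc k} _ _ = ℤ.+<+ (ℕ.s≤s ℕ.z≤n)
  *-pos {+ zero}  (ℤ.+<+ ())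
  *-pos {+ suc m} {+ zero} _ (ℤ.+<+ ())

  neg-nonneg⇒nonpos : ∀ {x} → 0ℤ ≤ - x → x ≤ 0ℤ
  neg-nonneg⇒nonpos {x} h = subst (_≤ 0ℤ) (ℤP.neg-involutive x) (ℤP.neg-mono-≤ h)

snoc-induction : ∀ {a p} {A : Set a} (P : List A → Set p) → P [] → (∀ u i → P u → P (u ++ i ∷ [])) → ∀ w → P w
snoc-induction P p[] p∷ʳ w = go (reverseView w)
  where go : ∀ {w} → Reverse w → P w
        go []           = p[]
        go (u ∶ r ∶ʳ i) = p∷ʳ u i (go r)

length≡0⇒≡[] : ∀ {a} {A : Set a} (xs : List A) → length xs ≡ 0 → xs ≡ []
length≡0⇒≡[] [] _ = refl

lookup-ext : ∀ {a} {A : Set a} {n} (u v : Vec A n) → (∀ i → lookup u i ≡ lookup v i) → u ≡ v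
lookup-ext u v p = trans (sym (VP.tabulate∘lookup u)) (trans (VP.tabulate-cong p) (VP.tabulate∘lookup v))

module _ {A : Set} where

  -- Affine.Card, for an arbitrary carrier
  HasCard : (A → Set) → ℕ → Set
  HasCard S k = Σ (List A) λ xs → length xs ≡ k × Unique xs × (∀ x → (x ∈ xs → S x) × (S x → x ∈ xs))

  card-unique : ∀ {S k k′} → HasCard S k → HasCard S k′ → k ≡ k′
  card-unique (xs , refl , u , h) (ys , refl , u′ , h′) =
    ↭-length (∼bag⇒↭ (unique∧set⇒bag u u′ (mk⇔ (λ m → proj₂ (h′ _) (proj₁ (h _) m))
                                                (λ m → proj₂ (h _) (proj₁ (h′ _) m)))))

  card-cong : ∀ {S T : A → Set} {k} → (∀ x → (S x → T x) × (T x → S x)) → HasCard S k → HasCard T k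
  card-cong S⇔T (xs , l , u , h) =
    xs , l , u , λ x → proj₁ (S⇔T x) ∘ proj₁ (h x) , proj₂ (h x) ∘ proj₂ (S⇔T x)

  card-empty : ∀ {S : A → Set} → (∀ x → ¬ S x) → HasCard S 0
  card-empty ¬S = [] , refl , [] , λ x → (λ ()) , ⊥-elim ∘ ¬S x

  card-singleton : ∀ {y} → HasCard (_≡ y) 1
  card-singleton {y} = y ∷ [] , refl , All.[] ∷ [] , λ x → (λ { (here x≡y) → x≡y }) , here

  card-insert : ∀ {S : A → Set} {k} {y} → ¬ S y → HasCard S k → HasCard (λ x → x ≡ y ⊎ S x) (suc k)
  card-insert {S} {y = y} ¬Sy (xs , l , u , h) =
    y ∷ xs , cong suc l , y∉xs ∷ u , λ x → to x , from x
    where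
      y∉xs : All (y ≢_) xs
      y∉xs = All.tabulate (λ m y≡x → ¬Sy (proj₁ (h _) (subst (_∈ xs) (sym y≡x) m)))
      to : ∀ x → x ∈ y ∷ xs → x ≡ y ⊎ S x
      to x (here x≡y) = inj₁ x≡y
      to x (there m)  = inj₂ (proj₁ (h x) m)
      from : ∀ x → x ≡ y ⊎ S x → x ∈ y ∷ xs
      from x (inj₁ x≡y) = here x≡y
      from x (inj₂ Sx)  = there (proj₂ (h x) Sx)

  card-image : ∀ {S T : A → Set} {k} (f g : A → A) → (∀ x → g (f x) ≡ x) → (∀ y → f (g y) ≡ y) →
               (∀ x → S x → T (f x)) → (∀ y → T y → S (g y)) → HasCard S k → HasCard T k
  card-image {S} {T} f g gf fg ST TS (xs , l , u , h) =
    L.map f xs , trans (LP.length-map f xs) l , Uniq.map⁺ f-injective u , λ y → to y , from y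
    where
      f-injective : ∀ {x x′} → f x ≡ f x′ → x ≡ x′
      f-injective {x} {x′} e = trans (sym (gf x)) (trans (cong g e) (gf x′))
      to : ∀ y → y ∈ L.map f xs → T y
      to y m with ∈-map⁻ f m
      ... | x , mx , refl = ST x (proj₁ (h x) mx)
      from : ∀ y → T y → y ∈ L.map f xs
      from y t = subst (_∈ L.map f xs) (fg y) (∈-map⁺ f (proj₂ (h (g y)) (TS y t)))

  length-filter-∁ : ∀ {P : A → Set} (P? : Decidable P) xs →
                    length (filter P? xs) ℕ.+ length (filter (∁? P?) xs) ≡ length xs
  length-filter-∁ P? []       = refl
  length-filter-∁ P? (x ∷ xs) with P? x
  ... | yes _ = cong suc (length-filter-∁ P? xs)
  ... | no _  = trans (ℕP.+-suc _ _) (cong suc (length-filter-∁ P? xs))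

  card-split : ∀ {S P : A → Set} (P? : Decidable P) {k} → HasCard S k →
               Σ ℕ λ a → Σ ℕ λ b → HasCard (λ x → S x × P x) a × HasCard (λ x → S x × ¬ P x) b × a ℕ.+ b ≡ k
  card-split {S} P? (xs , l , u , h) =
    _ , _ , part P? , part (∁? P?) , trans (length-filter-∁ P? xs) l
    where
      part : ∀ {Q : A → Set} (Q? : Decidable Q) → HasCard (λ x → S x × Q x) (length (filter Q? xs))
      part Q? = filter Q? xs , refl , Uniq.filter⁺ Q? u ,
        λ x → (λ m → let (mx , q) = ∈-filter⁻ Q? m in proj₁ (h x) mx , q) ,
              (λ (s , q) → ∈-filter⁺ Q? (proj₂ (h x) s) q)

module _ where
  open import Data.Integer using (_+_; _*_)

  /1-homo-+ : ∀ m k → + (m ℕ.+ k) ℚ./ 1 ≡ + m ℚ./ 1 ℚ.+ + k ℚ./ 1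
  /1-homo-+ m k = sym (trans (cong₂ ℚ._+_ (as-mkℚ m) (as-mkℚ k)) (cong (ℚ._/ 1) numerator))
    where
      as-mkℚ : ∀ k → + k ℚ./ 1 ≡ ℚ.mkℚ (+ k) 0 (Coprime.sym (1-coprimeTo k))
      as-mkℚ k = ℚP.normalize-coprime (Coprime.sym (1-coprimeTo k))
      numerator : + m * + 1 + + k * + 1 ≡ + (m ℕ.+ k)
      numerator = trans (cong₂ _+_ (ℤP.*-identityʳ (+ m)) (ℤP.*-identityʳ (+ k))) (sym (ℤP.pos-+ m k))

  ℚ-balance : ∀ (P : ℚ) {x y b c : ℕ} → x ℕ.+ c ≡ y ℕ.+ b →
              P ℚ.+ + x ℚ./ 1 ℚ.- + y ℚ./ 1 ≡ P ℚ.+ + b ℚ./ 1 ℚ.- + c ℚ./ 1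
  ℚ-balance P {x} {y} {b} {c} x+c≡y+b =
    trans (solve 5 (λ P X Y B C → P :+ X :- Y := P :+ (X :+ C) :- Y :- C) refl P X Y B C)
    (trans (cong (λ t → P ℚ.+ t ℚ.- Y ℚ.- C) (trans (sym (/1-homo-+ x c)) (trans (cong (λ k → + k ℚ./ 1) x+c≡y+b) (/1-homo-+ y b))))
           (solve 5 (λ P X Y B C → P :+ (Y :+ B) :- Y :- C := P :+ B :- C) refl P X Y B C))
    where
      open +-*-Solver
      X Y B C : ℚ
      X = + x ℚ./ 1
      Y = + y ℚ./ 1
      B = + b ℚ./ 1
      C = + c ℚ./ 1

  ℚ-length-identities : ∀ (P : ℚ) {L L₀ Z A B B′ C C′ : ℚ} → L ≡ P ℚ.+ B′ ℚ.- C′ → L₀ ≡ P ℚ.+ Z ℚ.- Z →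
                        A ≡ C′ → B ≡ B′ → C ≡ C′ → (L ≡ L₀ ℚ.- A ℚ.+ B) × (L₀ ℚ.- A ℚ.+ B ≡ P ℚ.- C ℚ.+ B)
  ℚ-length-identities P {Z = Z} {B = B} {C = C} refl refl refl refl refl =
    solve 4 (λ P Z B C → P :+ B :- C := P :+ Z :- Z :- C :+ B) refl P Z B C ,
    solve 4 (λ P Z B C → P :+ Z :- Z :- C :+ B := P :- C :+ B) refl P Z B C
    where open +-*-Solver

module AffineRootSystem (C : SLCartan) (θ : Vec ℤ (SLCartan.n C)) where
  open SLCartan C
  open Affine C θ
  open import Data.Integer using (-_; _+_; _*_; _≤_; _<_)
  open import Relation.Nullary.Decidable using (⌊_⌋)

  lookup-+Q : ∀ (u v : Vec ℤ n) k → lookup (zipWith _+_ u v) k ≡ lookup u k + lookup v k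
  lookup-+Q u v k = VP.lookup-zipWith _+_ k u v

  lookup-·Q : ∀ (c : ℤ) (v : Vec ℤ n) k → lookup (V.map (c *_) v) k ≡ c * lookup v k
  lookup-·Q c v k = VP.lookup-map k (c *_) v

  lookup--Q : ∀ (v : Q) k → lookup (-Q v) k ≡ - lookup v k
  lookup--Q v k = VP.lookup-map k -_ v

  lookup-e : ∀ i j → lookup (e i) j ≡ (if ⌊ i F.≟ j ⌋ then 1ℤ else 0ℤ)
  lookup-e i j = VP.lookup∘tabulate _ j

  lookup-e-same : ∀ i → lookup (e i) i ≡ 1ℤ
  lookup-e-same i rewrite lookup-e i i with i F.≟ i
  ... | yes _ = refl
  ... | no i≢i = ⊥-elim (i≢i refl)

  lookup-e-other : ∀ i j → j ≢ i → lookup (e i) j ≡ 0ℤ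
  lookup-e-other i j j≢i rewrite lookup-e i j with i F.≟ j
  ... | yes i≡j = ⊥-elim (j≢i (sym i≡j))
  ... | no _    = refl

  lookup-toP : ∀ v j → lookup (toP v) j ≡ Σᶠ (λ i → lookup v i * A i j)
  lookup-toP v j = VP.lookup∘tabulate (λ j → Σᶠ (λ i → lookup v i * A i j)) j

  toP-+ : ∀ u v j → lookup (toP (u +Q v)) j ≡ lookup (toP u) j + lookup (toP v) j
  toP-+ u v j = begin
    lookup (toP (u +Q v)) j                                   ≡⟨ lookup-toP (u +Q v) j ⟩
    Σᶠ (λ i → lookup (u +Q v) i * A i j)                      ≡⟨ Σᶠ-cong (λ i → trans (cong (_* A i j) (lookup-+Q u v i))
                                                                   (ℤP.*-distribʳ-+ (A i j) (lookup u i) (lookup v i))) ⟩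
    Σᶠ (λ i → lookup u i * A i j + lookup v i * A i j)        ≡⟨ Σᶠ-distrib-+ (λ i → lookup u i * A i j) (λ i → lookup v i * A i j) ⟩
    Σᶠ (λ i → lookup u i * A i j) + Σᶠ (λ i → lookup v i * A i j)
                                                              ≡⟨ sym (cong₂ _+_ (lookup-toP u j) (lookup-toP v j)) ⟩
    lookup (toP u) j + lookup (toP v) j                       ∎
    where open ≡-Reasoning

  toP-· : ∀ c v j → lookup (toP (c ·Q v)) j ≡ c * lookup (toP v) j
  toP-· c v j = begin
    lookup (toP (c ·Q v)) j                  ≡⟨ lookup-toP (c ·Q v) j ⟩
    Σᶠ (λ i → lookup (c ·Q v) i * A i j)     ≡⟨ Σᶠ-cong (λ i → trans (cong (_* A i j) (lookup-·Q c v i))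
                                                  (ℤP.*-assoc c (lookup v i) (A i j))) ⟩
    Σᶠ (λ i → c * (lookup v i * A i j))      ≡⟨ Σᶠ-distribˡ-* c (λ i → lookup v i * A i j) ⟩
    c * Σᶠ (λ i → lookup v i * A i j)        ≡⟨ cong (c *_) (sym (lookup-toP v j)) ⟩
    c * lookup (toP v) j                     ∎
    where open ≡-Reasoning

  pairQQ-sym : ∀ v w → pairQQ v w ≡ pairQQ w v
  pairQQ-sym v w = trans (Σᶠ-swap (λ i j → lookup v i * A i j * lookup w j))
    (Σᶠ-cong λ j → Σᶠ-cong λ i →
      trans (cong (λ a → lookup v i * a * lookup w j) (symm i j)) (reverse₃ (lookup v i) (A j i) (lookup w j)))
    where reverse₃ : ∀ a b c → a * b * c ≡ c * b * a
          reverse₃ = solve-∀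

  pairQP-toP : ∀ ν ν′ → pairQP ν′ (toP ν) ≡ pairQQ ν ν′
  pairQP-toP ν ν′ =
    trans (Σᶠ-cong λ j → trans (cong (lookup ν′ j *_) (lookup-toP ν j))
                               (sym (Σᶠ-distribˡ-* (lookup ν′ j) (λ i → lookup ν i * A i j))))
    (trans (Σᶠ-cong λ j → Σᶠ-cong λ i → rotate (lookup ν′ j) (lookup ν i) (A i j))
           (sym (Σᶠ-swap (λ i j → lookup ν i * A i j * lookup ν′ j))))
    where rotate : ∀ a b c → a * (b * c) ≡ b * c * a
          rotate = solve-∀

  pairQP-+ˡ : ∀ u v μ → pairQP (u +Q v) μ ≡ pairQP u μ + pairQP v μ
  pairQP-+ˡ u v μ =
    trans (Σᶠ-cong λ i → trans (cong (_* lookup μ i) (lookup-+Q u v i))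
                               (ℤP.*-distribʳ-+ (lookup μ i) (lookup u i) (lookup v i)))
          (Σᶠ-distrib-+ (λ i → lookup u i * lookup μ i) (λ i → lookup v i * lookup μ i))

  pairQP-·ˡ : ∀ c v μ → pairQP (c ·Q v) μ ≡ c * pairQP v μ
  pairQP-·ˡ c v μ =
    trans (Σᶠ-cong λ i → trans (cong (_* lookup μ i) (lookup-·Q c v i)) (ℤP.*-assoc c (lookup v i) (lookup μ i)))
          (Σᶠ-distribˡ-* c (λ i → lookup v i * lookup μ i))

  pairQP-negˡ : ∀ v μ → pairQP (-Q v) μ ≡ - pairQP v μ
  pairQP-negˡ v μ =
    trans (Σᶠ-cong λ i → trans (cong (_* lookup μ i) (lookup--Q v i)) (sym (ℤP.neg-distribˡ-* (lookup v i) (lookup μ i))))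
          (Σᶠ-neg (λ i → lookup v i * lookup μ i))

  pairQP-+ʳ : ∀ v μ μ′ → pairQP v (zipWith _+_ μ μ′) ≡ pairQP v μ + pairQP v μ′
  pairQP-+ʳ v μ μ′ =
    trans (Σᶠ-cong λ i → trans (cong (lookup v i *_) (lookup-+Q μ μ′ i))
                               (ℤP.*-distribˡ-+ (lookup v i) (lookup μ i) (lookup μ′ i)))
          (Σᶠ-distrib-+ (λ i → lookup v i * lookup μ i) (λ i → lookup v i * lookup μ′ i))

  pairQP-·ʳ : ∀ c v μ → pairQP v (V.map (c *_) μ) ≡ c * pairQP v μ
  pairQP-·ʳ c v μ =
    trans (Σᶠ-cong λ i → trans (cong (lookup v i *_) (lookup-·Q c μ i)) (swap₁₂ (lookup v i) c (lookup μ i)))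
          (Σᶠ-distribˡ-* c (λ i → lookup v i * lookup μ i))
    where swap₁₂ : ∀ a b d → a * (b * d) ≡ b * (a * d)
          swap₁₂ = solve-∀

  pairQP-e : ∀ k μ → pairQP (e k) μ ≡ lookup μ k
  pairQP-e k μ =
    trans (Σᶠ-single _ k (λ j j≢k → cong (_* lookup μ j) (lookup-e-other k j j≢k)))
          (trans (cong (_* lookup μ k) (lookup-e-same k)) (ℤP.*-identityˡ (lookup μ k)))

  pairQP-eʳ : ∀ k ν → pairQP ν (e k) ≡ lookup ν k
  pairQP-eʳ k ν =
    trans (Σᶠ-single _ k (λ j j≢k → trans (cong (lookup ν j *_) (lookup-e-other k j j≢k)) (ℤP.*-zeroʳ (lookup ν j))))
          (trans (cong (lookup ν k *_) (lookup-e-same k)) (ℤP.*-identityʳ (lookup ν k)))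

  pairQP-zeroʳ : ∀ ν → pairQP ν (replicate n 0ℤ) ≡ 0ℤ
  pairQP-zeroʳ ν =
    trans (Σᶠ-cong λ i → trans (cong (lookup ν i *_) (VP.lookup-replicate i 0ℤ)) (ℤP.*-zeroʳ (lookup ν i)))
          (Σᶠ-zero {n})

  pairQQ-+ʳ : ∀ u v w → pairQQ w (u +Q v) ≡ pairQQ w u + pairQQ w v
  pairQQ-+ʳ u v w = trans (sym (pairQP-toP w (u +Q v)))
    (trans (pairQP-+ˡ u v (toP w)) (cong₂ _+_ (pairQP-toP w u) (pairQP-toP w v)))

  pairQQ-·ʳ : ∀ c v w → pairQQ w (c ·Q v) ≡ c * pairQQ w v
  pairQQ-·ʳ c v w = trans (sym (pairQP-toP w (c ·Q v)))
    (trans (pairQP-·ˡ c v (toP w)) (cong (c *_) (pairQP-toP w v)))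

  pairQQ-negʳ : ∀ v w → pairQQ w (-Q v) ≡ - pairQQ w v
  pairQQ-negʳ v w = trans (sym (pairQP-toP w (-Q v)))
    (trans (pairQP-negˡ v (toP w)) (cong -_ (pairQP-toP w v)))

  pairQQ-+ˡ : ∀ u v w → pairQQ (u +Q v) w ≡ pairQQ u w + pairQQ v w
  pairQQ-+ˡ u v w = trans (pairQQ-sym (u +Q v) w)
    (trans (pairQQ-+ʳ u v w) (cong₂ _+_ (pairQQ-sym w u) (pairQQ-sym w v)))

  pairQQ-·ˡ : ∀ c v w → pairQQ (c ·Q v) w ≡ c * pairQQ v w
  pairQQ-·ˡ c v w = trans (pairQQ-sym (c ·Q v) w) (trans (pairQQ-·ʳ c v w) (cong (c *_) (pairQQ-sym w v)))

  pairQQ-negˡ : ∀ v w → pairQQ (-Q v) w ≡ - pairQQ v w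
  pairQQ-negˡ v w = trans (pairQQ-sym (-Q v) w) (trans (pairQQ-negʳ v w) (cong -_ (pairQQ-sym w v)))

  pairQQ-e : ∀ v k → pairQQ v (e k) ≡ lookup (toP v) k
  pairQQ-e v k = trans (sym (pairQP-toP v (e k))) (pairQP-e k (toP v))

  pairQQ-ee : ∀ i k → pairQQ (e i) (e k) ≡ A i k
  pairQQ-ee i k = trans (pairQQ-e (e i) k) (trans (lookup-toP (e i) k)
    (trans (Σᶠ-single _ i (λ j j≢i → cong (_* A j k) (lookup-e-other i j j≢i)))
           (trans (cong (_* A i k) (lookup-e-same i)) (ℤP.*-identityˡ (A i k)))))

  AR-ext : ∀ {β γ : AR} → (∀ k → lookup (proj₁ β) k ≡ lookup (proj₁ γ) k) → proj₂ β ≡ proj₂ γ → β ≡ γ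
  AR-ext {β} {γ} p q = cong₂ _,_ (lookup-ext (proj₁ β) (proj₁ γ) p) q

  X-ext : ∀ {x y : X} → (∀ k → lookup (μ x) k ≡ lookup (μ y) k) → m x ≡ m y → l x ≡ l y → x ≡ y
  X-ext {x} {y} p refl refl = cong (λ ν → mkX ν (m x) (l x)) (lookup-ext (μ x) (μ y) p)

  -- ν + rδ as the level-0 element of X (ν converted to weight coordinates)
  embX : AR → X
  embX β = mkX (toP (proj₁ β)) (proj₂ β) 0ℤ

  embX-α : ∀ i → embX (αA i) ≡ αX i
  embX-α zero    = refl
  embX-α (suc i) = refl

  negA : AR → AR
  negA (ν , r) = (-Q ν , - r)

  reflA : AR → AR → AR
  reflA γ β = β +A ((- pairAA β γ) ·A γ)

  reflX : AR → X → X
  reflX γ x = x +X ((- pairXA x γ) ·X embX γ)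

  sX≡reflX : ∀ i x → sX i x ≡ reflX (αA i) x
  sX≡reflX i x = cong (λ α → x +X ((- pairXA x (αA i)) ·X α)) (sym (embX-α i))

  pairXA-+ˡ : ∀ x y β → pairXA (x +X y) β ≡ pairXA x β + pairXA y β
  pairXA-+ˡ x y β = trans (cong (_+ (l x + l y) * proj₂ β) (pairQP-+ʳ (proj₁ β) (μ x) (μ y)))
    (lem (pairQP (proj₁ β) (μ x)) (pairQP (proj₁ β) (μ y)) (l x) (l y) (proj₂ β))
    where lem : ∀ a b c d r → a + b + (c + d) * r ≡ a + c * r + (b + d * r)
          lem = solve-∀

  pairXA-·ˡ : ∀ c x β → pairXA (c ·X x) β ≡ c * pairXA x β
  pairXA-·ˡ c x β = trans (cong (_+ (c * l x) * proj₂ β) (pairQP-·ʳ c (proj₁ β) (μ x)))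
    (lem c (pairQP (proj₁ β) (μ x)) (l x) (proj₂ β))
    where lem : ∀ c a d r → c * a + c * d * r ≡ c * (a + d * r)
          lem = solve-∀

  pairXA-+ʳ : ∀ x β γ → pairXA x (β +A γ) ≡ pairXA x β + pairXA x γ
  pairXA-+ʳ x β γ = trans (cong (_+ l x * (proj₂ β + proj₂ γ)) (pairQP-+ˡ (proj₁ β) (proj₁ γ) (μ x)))
    (lem (pairQP (proj₁ β) (μ x)) (pairQP (proj₁ γ) (μ x)) (l x) (proj₂ β) (proj₂ γ))
    where lem : ∀ a b d r s → a + b + d * (r + s) ≡ a + d * r + (b + d * s)
          lem = solve-∀

  pairXA-·ʳ : ∀ c x β → pairXA x (c ·A β) ≡ c * pairXA x β
  pairXA-·ʳ c x β = trans (cong (_+ l x * (c * proj₂ β)) (pairQP-·ˡ c (proj₁ β) (μ x)))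
    (lem c (pairQP (proj₁ β) (μ x)) (l x) (proj₂ β))
    where lem : ∀ c a d r → c * a + d * (c * r) ≡ c * (a + d * r)
          lem = solve-∀

  pairXA-negʳ : ∀ x β → pairXA x (negA β) ≡ - pairXA x β
  pairXA-negʳ x (ν , r) =
    trans (cong₂ _+_ (pairQP-negˡ ν (μ x)) (sym (ℤP.neg-distribʳ-* (l x) r)))
          (sym (ℤP.neg-distrib-+ (pairQP ν (μ x)) (l x * r)))

  pairXA-embX : ∀ γ β → pairXA (embX γ) β ≡ pairAA β γ
  pairXA-embX γ β = trans (cong₂ _+_ (pairQP-toP (proj₁ γ) (proj₁ β)) (ℤP.*-zeroˡ (proj₂ β)))
    (trans (ℤP.+-identityʳ _) (pairQQ-sym (proj₁ γ) (proj₁ β)))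

  lookup-reflA : ∀ γ β k → lookup (proj₁ (reflA γ β)) k ≡ lookup (proj₁ β) k + (- pairAA β γ) * lookup (proj₁ γ) k
  lookup-reflA γ β k = trans (lookup-+Q (proj₁ β) _ k) (cong (_+_ (lookup (proj₁ β) k)) (lookup-·Q (- pairAA β γ) (proj₁ γ) k))

  lookup-reflX : ∀ γ x k → lookup (μ (reflX γ x)) k ≡ lookup (μ x) k + (- pairXA x γ) * lookup (toP (proj₁ γ)) k
  lookup-reflX γ x k = trans (lookup-+Q (μ x) _ k) (cong (_+_ (lookup (μ x) k)) (lookup-·Q (- pairXA x γ) (toP (proj₁ γ)) k))

  pairAA-reflA : ∀ γ β δ → pairAA (reflA γ β) δ ≡ pairAA β δ + (- pairAA β γ) * pairAA γ δ
  pairAA-reflA γ β δ = trans (pairQQ-+ˡ (proj₁ β) (proj₁ ((- pairAA β γ) ·A γ)) (proj₁ δ))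
    (cong (_+_ (pairAA β δ)) (pairQQ-·ˡ (- pairAA β γ) (proj₁ γ) (proj₁ δ)))

  pairXA-reflX : ∀ γ x β → pairXA (reflX γ x) β ≡ pairXA x β + (- pairXA x γ) * pairAA β γ
  pairXA-reflX γ x β = trans (pairXA-+ˡ x ((- pairXA x γ) ·X embX γ) β)
    (cong (_+_ (pairXA x β)) (trans (pairXA-·ˡ (- pairXA x γ) (embX γ) β) (cong ((- pairXA x γ) *_) (pairXA-embX γ β))))

  pairXA-reflAʳ : ∀ γ x β → pairXA x (reflA γ β) ≡ pairXA x β + (- pairAA β γ) * pairXA x γ
  pairXA-reflAʳ γ x β = trans (pairXA-+ʳ x β _) (cong (_+_ (pairXA x β)) (pairXA-·ʳ (- pairAA β γ) x γ))

  module Reflection (γ : AR) (γ-norm : pairAA γ γ ≡ + 2) where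

    pairAA-reflA-self : ∀ β → pairAA (reflA γ β) γ ≡ - pairAA β γ
    pairAA-reflA-self β = trans (pairAA-reflA γ β γ) (trans (cong (λ z → pairAA β γ + (- pairAA β γ) * z) γ-norm)
      (lem (pairAA β γ)))
      where lem : ∀ p → p + (- p) * + 2 ≡ - p
            lem = solve-∀

    pairXA-reflX-self : ∀ x → pairXA (reflX γ x) γ ≡ - pairXA x γ
    pairXA-reflX-self x = trans (pairXA-reflX γ x γ) (trans (cong (λ z → pairXA x γ + (- pairXA x γ) * z) γ-norm)
      (lem (pairXA x γ)))
      where lem : ∀ p → p + (- p) * + 2 ≡ - p
            lem = solve-∀

    reflA-self : reflA γ γ ≡ negA γ
    reflA-self = AR-ext
      (λ k → trans (lookup-reflA γ γ k)
        (trans (cong (λ p → lookup (proj₁ γ) k + (- p) * lookup (proj₁ γ) k) γ-norm)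
               (trans (negate (lookup (proj₁ γ) k)) (sym (lookup--Q (proj₁ γ) k)))))
      (trans (cong (λ p → proj₂ γ + (- p) * proj₂ γ) γ-norm) (negate (proj₂ γ)))
      where negate : ∀ a → a + (- + 2) * a ≡ - a
            negate = solve-∀

    reflA-involutive : ∀ β → reflA γ (reflA γ β) ≡ β
    reflA-involutive β = AR-ext
      (λ k → trans (lookup-reflA γ (reflA γ β) k)
        (trans (cong₂ (λ a p → a + (- p) * lookup (proj₁ γ) k) (lookup-reflA γ β k) (pairAA-reflA-self β))
               (cancel (lookup (proj₁ β) k) (pairAA β γ) (lookup (proj₁ γ) k))))
      (trans (cong (λ p → proj₂ β + (- pairAA β γ) * proj₂ γ + (- p) * proj₂ γ) (pairAA-reflA-self β))
             (cancel (proj₂ β) (pairAA β γ) (proj₂ γ)))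
      where cancel : ∀ b p g → b + (- p) * g + (- (- p)) * g ≡ b
            cancel = solve-∀

    reflX-involutive : ∀ x → reflX γ (reflX γ x) ≡ x
    reflX-involutive x = X-ext
      (λ k → trans (lookup-reflX γ (reflX γ x) k)
        (trans (cong₂ (λ a p → a + (- p) * lookup (toP (proj₁ γ)) k) (lookup-reflX γ x k) (pairXA-reflX-self x))
               (cancel (lookup (μ x) k) (pairXA x γ) (lookup (toP (proj₁ γ)) k))))
      (trans (cong (λ p → m x + (- pairXA x γ) * proj₂ γ + (- p) * proj₂ γ) (pairXA-reflX-self x))
             (cancel (m x) (pairXA x γ) (proj₂ γ)))
      (trans (cong (λ p → l x + (- pairXA x γ) * 0ℤ + (- p) * 0ℤ) (pairXA-reflX-self x))
             (cancel (l x) (pairXA x γ) 0ℤ))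
      where cancel : ∀ b p g → b + (- p) * g + (- (- p)) * g ≡ b
            cancel = solve-∀

    reflA-isometry : ∀ β β′ → pairAA (reflA γ β) (reflA γ β′) ≡ pairAA β β′
    reflA-isometry β β′ =
      trans (pairAA-reflA γ β (reflA γ β′))
      (trans (cong₂ (λ u v → u + (- pairAA β γ) * v)
                    (trans (pairQQ-sym (proj₁ β) (proj₁ (reflA γ β′)))
                           (trans (pairAA-reflA γ β′ β) (cong (λ z → pairAA β′ β + (- pairAA β′ γ) * z) (pairQQ-sym (proj₁ γ) (proj₁ β)))))
                    (trans (pairQQ-sym (proj₁ γ) (proj₁ (reflA γ β′))) (pairAA-reflA-self β′)))
      (trans (lem (pairAA β′ β) (pairAA β γ) (pairAA β′ γ)) (pairQQ-sym (proj₁ β′) (proj₁ β))))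
      where lem : ∀ a p q → a + (- q) * p + (- p) * (- q) ≡ a
            lem = solve-∀

    reflX-pairing : ∀ x β → pairXA (reflX γ x) (reflA γ β) ≡ pairXA x β
    reflX-pairing x β =
      trans (pairXA-reflX γ x (reflA γ β))
      (trans (cong₂ (λ u v → u + (- pairXA x γ) * v) (pairXA-reflAʳ γ x β) (pairAA-reflA-self β))
             (lem (pairXA x β) (pairAA β γ) (pairXA x γ)))
      where lem : ∀ a p q → a + (- p) * q + (- q) * (- p) ≡ a
            lem = solve-∀

  embX-+ : ∀ β β′ → embX (β +A β′) ≡ embX β +X embX β′
  embX-+ β β′ = X-ext (λ k → trans (toP-+ (proj₁ β) (proj₁ β′) k) (sym (lookup-+Q (μ (embX β)) (μ (embX β′)) k))) refl refl

  embX-· : ∀ c β → embX (c ·A β) ≡ c ·X embX β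
  embX-· c β = X-ext (λ k → trans (toP-· c (proj₁ β) k) (sym (lookup-·Q c (μ (embX β)) k))) refl (sym (ℤP.*-zeroʳ c))

  reflX-embX : ∀ γ β → reflX γ (embX β) ≡ embX (reflA γ β)
  reflX-embX γ β =
    trans (cong (λ q → embX β +X ((- q) ·X embX γ)) (trans (pairXA-embX β γ) (pairQQ-sym (proj₁ γ) (proj₁ β))))
          (sym (trans (embX-+ β _) (cong (embX β +X_) (embX-· (- pairAA β γ) γ))))

  reflA-+ : ∀ δ β β′ → reflA δ (β +A β′) ≡ reflA δ β +A reflA δ β′
  reflA-+ δ β β′ = AR-ext
    (λ k → trans (lookup-reflA δ (β +A β′) k)
      (trans (cong₂ (λ u v → u + (- v) * lookup (proj₁ δ) k) (lookup-+Q (proj₁ β) (proj₁ β′) k) (pairQQ-+ˡ (proj₁ β) (proj₁ β′) (proj₁ δ)))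
      (trans (lem (lookup (proj₁ β) k) (lookup (proj₁ β′) k) (pairAA β δ) (pairAA β′ δ) (lookup (proj₁ δ) k))
             (sym (trans (lookup-+Q (proj₁ (reflA δ β)) (proj₁ (reflA δ β′)) k) (cong₂ _+_ (lookup-reflA δ β k) (lookup-reflA δ β′ k)))))))
    (trans (cong (λ v → proj₂ β + proj₂ β′ + (- v) * proj₂ δ) (pairQQ-+ˡ (proj₁ β) (proj₁ β′) (proj₁ δ)))
           (lem (proj₂ β) (proj₂ β′) (pairAA β δ) (pairAA β′ δ) (proj₂ δ)))
    where lem : ∀ a b p q d → a + b + (- (p + q)) * d ≡ a + (- p) * d + (b + (- q) * d)
          lem = solve-∀

  reflA-· : ∀ δ c β → reflA δ (c ·A β) ≡ c ·A reflA δ β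
  reflA-· δ c β = AR-ext
    (λ k → trans (lookup-reflA δ (c ·A β) k)
      (trans (cong₂ (λ u v → u + (- v) * lookup (proj₁ δ) k) (lookup-·Q c (proj₁ β) k) (pairQQ-·ˡ c (proj₁ β) (proj₁ δ)))
      (trans (lem c (lookup (proj₁ β) k) (pairAA β δ) (lookup (proj₁ δ) k))
             (sym (trans (lookup-·Q c (proj₁ (reflA δ β)) k) (cong (c *_) (lookup-reflA δ β k)))))))
    (trans (cong (λ v → c * proj₂ β + (- v) * proj₂ δ) (pairQQ-·ˡ c (proj₁ β) (proj₁ δ)))
           (lem c (proj₂ β) (pairAA β δ) (proj₂ δ)))
    where lem : ∀ c a p d → c * a + (- (c * p)) * d ≡ c * (a + (- p) * d)
          lem = solve-∀

  reflX-+ : ∀ δ x y → reflX δ (x +X y) ≡ reflX δ x +X reflX δ y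
  reflX-+ δ x y = X-ext
    (λ k → trans (lookup-reflX δ (x +X y) k)
      (trans (cong₂ (λ u v → u + (- v) * lookup (toP (proj₁ δ)) k) (lookup-+Q (μ x) (μ y) k) (pairXA-+ˡ x y δ))
      (trans (lem (lookup (μ x) k) (lookup (μ y) k) (pairXA x δ) (pairXA y δ) (lookup (toP (proj₁ δ)) k))
             (sym (trans (lookup-+Q (μ (reflX δ x)) (μ (reflX δ y)) k) (cong₂ _+_ (lookup-reflX δ x k) (lookup-reflX δ y k)))))))
    (trans (cong (λ v → m x + m y + (- v) * proj₂ δ) (pairXA-+ˡ x y δ)) (lem (m x) (m y) (pairXA x δ) (pairXA y δ) (proj₂ δ)))
    (trans (cong (λ v → l x + l y + (- v) * 0ℤ) (pairXA-+ˡ x y δ)) (lem (l x) (l y) (pairXA x δ) (pairXA y δ) 0ℤ))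
    where lem : ∀ a b p q d → a + b + (- (p + q)) * d ≡ a + (- p) * d + (b + (- q) * d)
          lem = solve-∀

  reflX-· : ∀ δ c x → reflX δ (c ·X x) ≡ c ·X reflX δ x
  reflX-· δ c x = X-ext
    (λ k → trans (lookup-reflX δ (c ·X x) k)
      (trans (cong₂ (λ u v → u + (- v) * lookup (toP (proj₁ δ)) k) (lookup-·Q c (μ x) k) (pairXA-·ˡ c x δ))
      (trans (lem c (lookup (μ x) k) (pairXA x δ) (lookup (toP (proj₁ δ)) k))
             (sym (trans (lookup-·Q c (μ (reflX δ x)) k) (cong (c *_) (lookup-reflX δ x k)))))))
    (trans (cong (λ v → c * m x + (- v) * proj₂ δ) (pairXA-·ˡ c x δ)) (lem c (m x) (pairXA x δ) (proj₂ δ)))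
    (trans (cong (λ v → c * l x + (- v) * 0ℤ) (pairXA-·ˡ c x δ)) (lem c (l x) (pairXA x δ) 0ℤ))
    where lem : ∀ c a p d → c * a + (- (c * p)) * d ≡ c * (a + (- p) * d)
          lem = solve-∀

  module Conjugation (δ : AR) (δ-norm : pairAA δ δ ≡ + 2) where
    open Reflection δ δ-norm

    reflA-conj : ∀ γ β → reflA δ (reflA γ β) ≡ reflA (reflA δ γ) (reflA δ β)
    reflA-conj γ β = trans (reflA-+ δ β ((- pairAA β γ) ·A γ))
      (trans (cong (reflA δ β +A_) (reflA-· δ (- pairAA β γ) γ))
             (cong (λ q → reflA δ β +A ((- q) ·A reflA δ γ)) (sym (reflA-isometry β γ))))

    reflX-conj : ∀ γ x → reflX δ (reflX γ x) ≡ reflX (reflA δ γ) (reflX δ x)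
    reflX-conj γ x = trans (reflX-+ δ x ((- pairXA x γ) ·X embX γ))
      (trans (cong (reflX δ x +X_) (trans (reflX-· δ (- pairXA x γ) (embX γ)) (cong ((- pairXA x γ) ·X_) (reflX-embX δ γ))))
             (cong (λ q → reflX δ x +X ((- q) ·X embX (reflA δ γ))) (sym (reflX-pairing x γ))))

  -- The finite root system

  reflQ : Q → Q → Q
  reflQ γ ν = ν +Q ((- pairQQ ν γ) ·Q γ)

  e-norm : ∀ i → pairAA (e i , 0ℤ) (e i , 0ℤ) ≡ + 2
  e-norm i = trans (pairQQ-ee i i) (diag i)

  sQ-isometry : ∀ i ν ν′ → pairQQ (sQ i ν) (sQ i ν′) ≡ pairQQ ν ν′
  sQ-isometry i ν ν′ = Reflection.reflA-isometry (e i , 0ℤ) (e-norm i) (ν , 0ℤ) (ν′ , 0ℤ)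

  sQ-involutive : ∀ i ν → sQ i (sQ i ν) ≡ ν
  sQ-involutive i ν = cong proj₁ (Reflection.reflA-involutive (e i , 0ℤ) (e-norm i) (ν , 0ℤ))

  sQ-conj : ∀ i γ ν → sQ i (reflQ γ ν) ≡ reflQ (sQ i γ) (sQ i ν)
  sQ-conj i γ ν = cong proj₁ (Conjugation.reflA-conj (e i , 0ℤ) (e-norm i) (γ , 0ℤ) (ν , 0ℤ))

  actFin-++ : ∀ u w ν → actFin (u ++ w) ν ≡ actFin u (actFin w ν)
  actFin-++ u w ν = LP.foldr-++ sQ ν u w

  actFin-inverse : ∀ w ν → actFin w (actFin (reverse w) ν) ≡ ν
  actFin-inverse []      ν = refl
  actFin-inverse (i ∷ w) ν =
    trans (cong (λ z → sQ i (actFin w z)) (trans (cong (λ u → actFin u ν) (LP.unfold-reverse i w)) (actFin-++ (reverse w) (i ∷ []) ν)))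
          (trans (cong (sQ i) (actFin-inverse w (sQ i ν))) (sQ-involutive i ν))

  actFin-norm : ∀ w ν → pairQQ (actFin w ν) (actFin w ν) ≡ pairQQ ν ν
  actFin-norm []      ν = refl
  actFin-norm (i ∷ w) ν = trans (sQ-isometry i (actFin w ν) (actFin w ν)) (actFin-norm w ν)

  actFin-conj : ∀ w γ ν → actFin w (reflQ γ ν) ≡ reflQ (actFin w γ) (actFin w ν)
  actFin-conj []      γ ν = refl
  actFin-conj (i ∷ w) γ ν = trans (cong (sQ i) (actFin-conj w γ ν)) (sQ-conj i (actFin w γ) (actFin w ν))

  root-norm : ∀ ν → IsRoot ν → pairQQ ν ν ≡ + 2
  root-norm ν (w , i , refl) = trans (actFin-norm w (e i)) (e-norm i)

  root-e : ∀ i → IsRoot (e i)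
  root-e i = [] , i , refl

  root-sQ : ∀ j ν → IsRoot ν → IsRoot (sQ j ν)
  root-sQ j ν (w , i , p) = j ∷ w , i , cong (sQ j) p

  reflQ-root-word : ∀ w j ν → reflQ (actFin w (e j)) ν ≡ actFin (w ++ j ∷ reverse w) ν
  reflQ-root-word w j ν =
    trans (cong (reflQ (actFin w (e j))) (sym (actFin-inverse w ν)))
          (trans (sym (actFin-conj w (e j) (actFin (reverse w) ν))) (sym (actFin-++ w (j ∷ reverse w) ν)))

  root-reflQ : ∀ γ ν → IsRoot γ → IsRoot ν → IsRoot (reflQ γ ν)
  root-reflQ γ ν (w , j , refl) (u , k , refl) =
    (w ++ j ∷ reverse w) ++ u , k ,
    trans (actFin-++ (w ++ j ∷ reverse w) u (e k)) (sym (reflQ-root-word w j (actFin u (e k))))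

  reflQ-self : ∀ ν → pairQQ ν ν ≡ + 2 → reflQ ν ν ≡ -Q ν
  reflQ-self ν ν-norm = cong proj₁ (Reflection.reflA-self (ν , 0ℤ) ν-norm)

  root-neg : ∀ ν → IsRoot ν → IsRoot (-Q ν)
  root-neg ν r = subst IsRoot (reflQ-self ν (root-norm ν r)) (root-reflQ ν ν r r)

  form-even : ∀ {k} (B : Fin k → Fin k → ℤ) → (∀ i j → B i j ≡ B j i) → (∀ i → B i i ≡ + 2) →
              ∀ v → ∃ λ h → form B v v ≡ + 2 * h
  form-even {zero}  B B-sym B-diag V.[]       = 0ℤ , refl
  form-even {suc k} B B-sym B-diag (x V.∷ xs) with form-even (λ i j → B (suc i) (suc j)) (λ i j → B-sym (suc i) (suc j)) (B-diag ∘ suc) xs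
  ... | h , eq = x * x + S + h ,
      trans (cong (λ z → x * B zero zero * x + S + z) rest)
      (trans (cong (λ z → x * z * x + S + (S + form (λ i j → B (suc i) (suc j)) xs xs)) (B-diag zero))
      (trans (cong (λ z → x * + 2 * x + S + (S + z)) eq) (lem x S h)))
    where
      S = Σᶠ (λ j → x * B zero (suc j) * lookup xs j)
      rest : Σᶠ (λ i → Σᶠ (λ j → lookup (x V.∷ xs) (suc i) * B (suc i) j * lookup (x V.∷ xs) j))
             ≡ S + form (λ i j → B (suc i) (suc j)) xs xs
      rest = trans (Σᶠ-distrib-+ (λ i → lookup xs i * B (suc i) zero * x) (λ i → Σᶠ (λ j → lookup xs i * B (suc i) (suc j) * lookup xs j)))
        (cong (_+ form (λ i j → B (suc i) (suc j)) xs xs)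
          (Σᶠ-cong λ i → trans (cong (λ z → lookup xs i * z * x) (B-sym (suc i) zero)) (reverse₃ (lookup xs i) (B zero (suc i)) x)))
        where reverse₃ : ∀ a b c → a * b * c ≡ c * b * a
              reverse₃ = solve-∀
      lem : ∀ x S h → x * + 2 * x + S + (S + + 2 * h) ≡ + 2 * (x * x + S + h)
      lem = solve-∀

  -- the form is positive definite and even
  form-nonzero≥2 : ∀ v → v ≢ replicate n 0ℤ → + 2 ≤ pairQQ v v
  form-nonzero≥2 v v≢0 with form-even A symm diag v | posdef v v≢0
  ... | h , eq | pos rewrite eq = go h pos
    where
      go : ∀ h → 0ℤ < + 2 * h → + 2 ≤ + 2 * h
      go (+ zero)    (ℤ.+<+ ())
      go (+ suc k)   _ = subst (+ 2 ≤_) (ℤP.pos-* 2 (suc k)) (ℤ.+≤+ (ℕP.m≤m*n 2 (suc k)))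
      go ℤ.-[1+ k ] ()

  posPart negPart : ℤ → ℤ
  posPart (+ k)      = + k
  posPart ℤ.-[1+ k ] = 0ℤ
  negPart (+ k)      = 0ℤ
  negPart ℤ.-[1+ k ] = + suc k

  posPart≥0 : ∀ x → 0ℤ ≤ posPart x
  posPart≥0 (+ k)      = ℤ.+≤+ ℕ.z≤n
  posPart≥0 ℤ.-[1+ k ] = ℤ.+≤+ ℕ.z≤n

  negPart≥0 : ∀ x → 0ℤ ≤ negPart x
  negPart≥0 (+ k)      = ℤ.+≤+ ℕ.z≤n
  negPart≥0 ℤ.-[1+ k ] = ℤ.+≤+ ℕ.z≤n

  posPart-negPart : ∀ x → posPart x + (- negPart x) ≡ x
  posPart-negPart (+ k)      = ℤP.+-identityʳ (+ k)
  posPart-negPart ℤ.-[1+ k ] = refl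

  posPart*negPart : ∀ x → posPart x * negPart x ≡ 0ℤ
  posPart*negPart (+ k)      = ℤP.*-zeroʳ (+ k)
  posPart*negPart ℤ.-[1+ k ] = refl

  posPart≡0 : ∀ x → posPart x ≡ 0ℤ → 0ℤ ≤ - x
  posPart≡0 (+ zero)   _ = ℤ.+≤+ ℕ.z≤n
  posPart≡0 ℤ.-[1+ k ] _ = ℤ.+≤+ ℕ.z≤n

  negPart≡0 : ∀ x → negPart x ≡ 0ℤ → 0ℤ ≤ x
  negPart≡0 (+ k) _ = ℤ.+≤+ ℕ.z≤n

  offdiag-term≤0 : ∀ i j (a b : ℤ) → 0ℤ ≤ a → 0ℤ ≤ b → (i ≡ j → a * b ≡ 0ℤ) → a * A i j * b ≤ 0ℤ
  offdiag-term≤0 i j a b a≥0 b≥0 disjoint with i F.≟ j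
  ... | yes refl = ℤP.≤-reflexive (trans (lem a (A i i) b) (trans (cong (A i i *_) (disjoint refl)) (ℤP.*-zeroʳ (A i i))))
    where lem : ∀ a c b → a * c * b ≡ c * (a * b)
          lem = solve-∀
  ... | no i≢j with offdiag i j i≢j
  ...   | inj₁ Aij≡0  rewrite Aij≡0  = ℤP.≤-reflexive (trans (cong (_* b) (ℤP.*-zeroʳ a)) (ℤP.*-zeroˡ b))
  ...   | inj₂ Aij≡-1 rewrite Aij≡-1 = subst (_≤ 0ℤ) (sym (lem a b)) (ℤP.neg-mono-≤ (*-nonneg a≥0 b≥0))
    where lem : ∀ a b → a * (- 1ℤ) * b ≡ - (a * b)
          lem = solve-∀

  -- Writing ν = p − q with p, q ≥ 0 of disjoint support gives ⟨ν,ν⟩ = ⟨p,p⟩ + ⟨q,q⟩ − 2⟨p,q⟩ ≥ 4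
  -- as soon as p and q are both nonzero, since ⟨p,q⟩ ≤ 0 (the off-diagonal entries of A are ≤ 0).
  norm2-pos⊎neg : ∀ ν → pairQQ ν ν ≡ + 2 → PosQ ν ⊎ PosQ (-Q ν)
  norm2-pos⊎neg ν ν-norm with VP.≡-dec ℤ._≟_ p (replicate n 0ℤ) | VP.≡-dec ℤ._≟_ q (replicate n 0ℤ)
    where p = tabulate (posPart ∘ lookup ν)
          q = tabulate (negPart ∘ lookup ν)
  ... | yes p≡0 | _ = inj₂ λ k → subst (0ℤ ≤_) (sym (lookup--Q ν k))
          (posPart≡0 (lookup ν k) (trans (sym (VP.lookup∘tabulate (posPart ∘ lookup ν) k))
                                         (trans (cong (λ z → lookup z k) p≡0) (VP.lookup-replicate k 0ℤ))))
  ... | no _ | yes q≡0 = inj₁ λ k →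
          negPart≡0 (lookup ν k) (trans (sym (VP.lookup∘tabulate (negPart ∘ lookup ν) k))
                                        (trans (cong (λ z → lookup z k) q≡0) (VP.lookup-replicate k 0ℤ)))
  ... | no p≢0 | no q≢0 = ⊥-elim (ℤP.<-irrefl (sym ν-norm) (ℤP.<-≤-trans (ℤ.+<+ (ℕ.s≤s (ℕ.s≤s (ℕ.s≤s ℕ.z≤n)))) four≤))
    where
      p = tabulate (posPart ∘ lookup ν)
      q = tabulate (negPart ∘ lookup ν)
      lookup-p : ∀ k → lookup p k ≡ posPart (lookup ν k)
      lookup-p = VP.lookup∘tabulate (posPart ∘ lookup ν)
      lookup-q : ∀ k → lookup q k ≡ negPart (lookup ν k)
      lookup-q = VP.lookup∘tabulate (negPart ∘ lookup ν)
      ν≡p-q : ν ≡ p +Q (-Q q)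
      ν≡p-q = lookup-ext _ _ λ k → sym (trans (lookup-+Q p (-Q q) k)
        (trans (cong₂ _+_ (lookup-p k) (trans (lookup--Q q k) (cong -_ (lookup-q k)))) (posPart-negPart (lookup ν k))))
      ⟨p,q⟩≤0 : pairQQ p q ≤ 0ℤ
      ⟨p,q⟩≤0 = Σᶠ-nonpos _ λ i → Σᶠ-nonpos _ λ j →
        subst₂ (λ u v → u * A i j * v ≤ 0ℤ) (sym (lookup-p i)) (sym (lookup-q j))
          (offdiag-term≤0 i j _ _ (posPart≥0 (lookup ν i)) (negPart≥0 (lookup ν j)) (λ { refl → posPart*negPart (lookup ν i) }))
      expand : pairQQ ν ν ≡ pairQQ p p + pairQQ q q + (- (+ 2)) * pairQQ p q
      expand = trans (cong (λ z → pairQQ z z) ν≡p-q)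
        (trans (pairQQ-+ˡ p (-Q q) (p +Q (-Q q)))
        (trans (cong₂ _+_ (trans (pairQQ-+ʳ p (-Q q) p) (cong (_+_ (pairQQ p p)) (pairQQ-negʳ q p)))
                          (trans (pairQQ-negˡ q (p +Q (-Q q))) (cong -_ (trans (pairQQ-+ʳ p (-Q q) q) (cong (_+_ (pairQQ q p)) (pairQQ-negʳ q q))))))
        (trans (cong (λ z → pairQQ p p + (- pairQQ p q) + (- (z + (- pairQQ q q)))) (pairQQ-sym q p))
               (lem (pairQQ p p) (pairQQ p q) (pairQQ q q)))))
        where lem : ∀ a b c → a + (- b) + (- (b + (- c))) ≡ a + c + (- (+ 2)) * b
              lem = solve-∀
      four≤ : + 4 ≤ pairQQ ν ν
      four≤ = subst (+ 4 ≤_) (sym expand)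
        (ℤP.+-mono-≤ (ℤP.+-mono-≤ (form-nonzero≥2 p p≢0) (form-nonzero≥2 q q≢0))
                     (subst (0ℤ ≤_) (lem (pairQQ p q)) (ℤP.neg-mono-≤ (ℤP.+-mono-≤ ⟨p,q⟩≤0 ⟨p,q⟩≤0))))
        where lem : ∀ b → - (b + b) ≡ (- (+ 2)) * b
              lem = solve-∀

  norm2-nonzero : ∀ ν → pairQQ ν ν ≡ + 2 → ¬ (∀ k → lookup ν k ≡ 0ℤ)
  norm2-nonzero ν ν-norm ν≡0
    with trans (sym ν-norm) (trans (Σᶠ-cong λ i → trans (Σᶠ-cong λ j → cong (λ u → u * A i j * lookup ν j) (ν≡0 i)) (Σᶠ-zero {n}))
                                   (Σᶠ-zero {n}))
  ... | ()

  norm2-¬pos×neg : ∀ ν → pairQQ ν ν ≡ + 2 → PosQ ν → ¬ PosQ (-Q ν)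
  norm2-¬pos×neg ν ν-norm ν≥0 -ν≥0 =
    norm2-nonzero ν ν-norm λ k → ℤP.≤-antisym (neg-nonneg⇒nonpos (subst (0ℤ ≤_) (lookup--Q ν k) (-ν≥0 k))) (ν≥0 k)

  norm2-supported⇒e : ∀ ν i → pairQQ ν ν ≡ + 2 → 0ℤ ≤ lookup ν i → (∀ j → j ≢ i → lookup ν j ≡ 0ℤ) → ν ≡ e i
  norm2-supported⇒e ν i ν-norm νᵢ≥0 ν₋ᵢ≡0 = lookup-ext ν (e i) λ j → coordinate j (j F.≟ i)
    where
      norm≡ : pairQQ ν ν ≡ lookup ν i * A i i * lookup ν i
      norm≡ = trans (Σᶠ-single _ i (λ a a≢i → trans (Σᶠ-cong λ b → cong (λ u → u * A a b * lookup ν b) (ν₋ᵢ≡0 a a≢i)) (Σᶠ-zero {n})))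
                    (Σᶠ-single _ i (λ b b≢i → trans (cong (lookup ν i * A i b *_) (ν₋ᵢ≡0 b b≢i)) (ℤP.*-zeroʳ (lookup ν i * A i b))))
      unit : ∀ x → 0ℤ ≤ x → x * + 2 * x ≡ + 2 → x ≡ 1ℤ
      unit (+ suc zero)    _ _  = refl
      unit (+ suc (suc k)) _ eq with ℕP.m+n≡0⇒n≡0 k (ℕP.suc-injective (ℕP.suc-injective (ℤP.+-injective eq)))
      ... | ()
      νᵢ≡1 : lookup ν i ≡ 1ℤ
      νᵢ≡1 = unit (lookup ν i) νᵢ≥0 (trans (cong (λ c → lookup ν i * c * lookup ν i) (sym (diag i))) (trans (sym norm≡) ν-norm))
      coordinate : ∀ j → Dec (j ≡ i) → lookup ν j ≡ lookup (e i) j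
      coordinate j (yes refl) = trans νᵢ≡1 (sym (lookup-e-same i))
      coordinate j (no j≢i)   = trans (ν₋ᵢ≡0 j j≢i) (sym (lookup-e-other i j j≢i))

  -- Affine roots

  affRoot-negA : ∀ β → IsAffRoot β → IsAffRoot (negA β)
  affRoot-negA (ν , r) = root-neg ν

  negA-involutive : ∀ β → negA (negA β) ≡ β
  negA-involutive (ν , r) =
    AR-ext (λ k → trans (lookup--Q (-Q ν) k) (trans (cong -_ (lookup--Q ν k)) (ℤP.neg-involutive (lookup ν k))))
           (ℤP.neg-involutive r)

  PosAR? : ∀ β → Dec (PosAR β)
  PosAR? (ν , r) with 0ℤ ℤP.<? r | r ℤ.≟ 0ℤ | FP.all? (λ k → 0ℤ ℤP.≤? lookup ν k)
  ... | yes r>0 | _      | _      = yes (inj₁ r>0)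
  ... | no _    | yes r≡0 | yes ν≥0 = yes (inj₂ (r≡0 , ν≥0))
  ... | no r≯0  | no r≢0 | _      = no λ { (inj₁ r>0) → r≯0 r>0 ; (inj₂ (r≡0 , _)) → r≢0 r≡0 }
  ... | no r≯0  | _      | no ν≱0 = no λ { (inj₁ r>0) → r≯0 r>0 ; (inj₂ (_ , ν≥0)) → ν≱0 ν≥0 }

  NegAR? : ∀ β → Dec (NegAR β)
  NegAR? β = PosAR? (negA β)

  affRoot-pos⊎neg : ∀ β → IsAffRoot β → PosAR β ⊎ NegAR β
  affRoot-pos⊎neg (ν , r) ν-root with ℤP.<-cmp 0ℤ r
  ... | tri< r>0 _ _ = inj₁ (inj₁ r>0)
  ... | tri> _ _ r<0 = inj₂ (inj₁ (ℤP.neg-mono-< r<0))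
  ... | tri≈ _ refl _ with norm2-pos⊎neg ν (root-norm ν ν-root)
  ...   | inj₁ ν≥0  = inj₁ (inj₂ (refl , ν≥0))
  ...   | inj₂ -ν≥0 = inj₂ (inj₂ (refl , -ν≥0))

  affRoot-¬pos×neg : ∀ β → IsAffRoot β → PosAR β → ¬ NegAR β
  affRoot-¬pos×neg (ν , r) _ (inj₁ r>0) (inj₁ -r>0) = ℤP.<-asym r>0 (subst (_< 0ℤ) (ℤP.neg-involutive r) (ℤP.neg-mono-< -r>0))
  affRoot-¬pos×neg (ν , r) _ (inj₁ r>0) (inj₂ (-r≡0 , _)) = ℤP.<-irrefl (sym (trans (sym (ℤP.neg-involutive r)) (cong -_ -r≡0))) r>0
  affRoot-¬pos×neg (ν , r) _ (inj₂ (r≡0 , _)) (inj₁ -r>0) = ℤP.<-irrefl (sym (cong -_ r≡0)) -r>0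
  affRoot-¬pos×neg (ν , r) ν-root (inj₂ (_ , ν≥0)) (inj₂ (_ , -ν≥0)) = norm2-¬pos×neg ν (root-norm ν ν-root) ν≥0 -ν≥0

  affRoot-¬pos⇒neg : ∀ β → IsAffRoot β → ¬ PosAR β → NegAR β
  affRoot-¬pos⇒neg β β-root ¬pos with affRoot-pos⊎neg β β-root
  ... | inj₁ pos = ⊥-elim (¬pos pos)
  ... | inj₂ neg = neg

  affRoot-¬neg⇒pos : ∀ β → IsAffRoot β → ¬ NegAR β → PosAR β
  affRoot-¬neg⇒pos β β-root ¬neg with affRoot-pos⊎neg β β-root
  ... | inj₁ pos = pos
  ... | inj₂ neg = ⊥-elim (¬neg neg)

  module HighestRoot (hθ : IsHighestRoot θ) where

    θ-root : IsRoot θ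
    θ-root = proj₁ hθ

    θ-norm : pairQQ θ θ ≡ + 2
    θ-norm = root-norm θ θ-root

    θ+root≥0 : ∀ ν → IsRoot ν → ∀ k → 0ℤ ≤ lookup θ k + lookup ν k
    θ+root≥0 ν ν-root k = subst (0ℤ ≤_)
      (trans (lookup-+Q θ (-Q (-Q ν)) k) (cong (_+_ (lookup θ k)) (trans (lookup--Q (-Q ν) k) (trans (cong -_ (lookup--Q ν k)) (ℤP.neg-involutive _)))))
      (proj₂ hθ (-Q ν) (root-neg ν ν-root) k)

    θ-pos : PosQ θ
    θ-pos k = half (lookup θ k) (θ+root≥0 θ θ-root k)
      where half : ∀ x → 0ℤ ≤ x + x → 0ℤ ≤ x
            half (+ k)      _ = ℤ.+≤+ ℕ.z≤n
            half ℤ.-[1+ k ] ()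

    θ-dominant : ∀ j → 0ℤ ≤ pairQQ θ (e j)
    θ-dominant j = subst (0ℤ ≤_) coefficient (proj₂ hθ (sQ j θ) (root-sQ j θ θ-root) j)
      where
        coefficient : lookup (θ +Q (-Q (sQ j θ))) j ≡ pairQQ θ (e j)
        coefficient =
          trans (lookup-+Q θ (-Q (sQ j θ)) j) (trans (cong (_+_ (lookup θ j)) (trans (lookup--Q (sQ j θ) j)
            (cong -_ (trans (lookup-+Q θ ((- pairQQ θ (e j)) ·Q e j) j)
              (cong (_+_ (lookup θ j)) (trans (lookup-·Q (- pairQQ θ (e j)) (e j) j) (cong ((- pairQQ θ (e j)) *_) (lookup-e-same j))))))))
          (lem (lookup θ j) (pairQQ θ (e j))))
          where lem : ∀ a c → a + (- (a + (- c) * 1ℤ)) ≡ c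
                lem = solve-∀

    pairθ-nonneg : ∀ ν → PosQ ν → 0ℤ ≤ pairQQ ν θ
    pairθ-nonneg ν ν≥0 = subst (0ℤ ≤_) (trans (pairQP-toP θ ν) (pairQQ-sym θ ν))
      (Σᶠ-nonneg _ λ i → *-nonneg (ν≥0 i) (subst (0ℤ ≤_) (pairQQ-e θ i) (θ-dominant i)))

    -- ⟨ν+θ, ν+θ⟩ = 4 + 2⟨ν,θ⟩ is positive unless ν = −θ
    pairθ≥-1 : ∀ ν → IsRoot ν → ν ≡ -Q θ ⊎ - 1ℤ ≤ pairQQ ν θ
    pairθ≥-1 ν ν-root with VP.≡-dec ℤ._≟_ (ν +Q θ) (replicate n 0ℤ)
    ... | yes ν+θ≡0 = inj₁ (lookup-ext ν (-Q θ) λ k →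
          trans (lem (lookup ν k) (lookup θ k))
                (trans (cong (_+ (- lookup θ k)) (trans (sym (lookup-+Q ν θ k)) (trans (cong (λ u → lookup u k) ν+θ≡0) (VP.lookup-replicate k 0ℤ))))
                       (trans (ℤP.+-identityˡ _) (sym (lookup--Q θ k)))))
      where lem : ∀ a b → a ≡ a + b + (- b)
            lem = solve-∀
    ... | no ν+θ≢0 = inj₂ (go (pairQQ ν θ) (subst (0ℤ <_) expand (posdef (ν +Q θ) ν+θ≢0)))
      where
        expand : pairQQ (ν +Q θ) (ν +Q θ) ≡ + 4 + + 2 * pairQQ ν θ
        expand = trans (pairQQ-+ˡ ν θ (ν +Q θ)) (trans (cong₂ _+_ (pairQQ-+ʳ ν θ ν) (pairQQ-+ʳ ν θ θ))
          (trans (cong₂ (λ a b → a + pairQQ ν θ + (b + pairQQ θ θ)) (root-norm ν ν-root) (pairQQ-sym θ ν))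
          (trans (cong (λ z → + 2 + pairQQ ν θ + (pairQQ ν θ + z)) θ-norm) (lem (pairQQ ν θ)))))
          where lem : ∀ t → + 2 + t + (t + + 2) ≡ + 4 + + 2 * t
                lem = solve-∀
        go : ∀ t → 0ℤ < + 4 + + 2 * t → - 1ℤ ≤ t
        go (+ k)               _ = ℤ.-≤+
        go ℤ.-[1+ zero ]       _ = ℤ.-≤- ℕ.z≤n
        go ℤ.-[1+ suc m ] h = ⊥-elim (ℤP.<-irrefl refl (ℤP.<-≤-trans h
          (ℤP.+-monoʳ-≤ (+ 4) {+ 2 * ℤ.-[1+ suc m ]} {+ 2 * ℤ.-[1+ 1 ]} (ℤP.*-monoˡ-≤-nonNeg (+ 2) (ℤ.-≤- (ℕ.s≤s ℕ.z≤n))))))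

    α-norm : ∀ i → pairAA (αA i) (αA i) ≡ + 2
    α-norm zero    = trans (pairQQ-negˡ θ (-Q θ)) (trans (cong -_ (pairQQ-negʳ θ θ)) (trans (ℤP.neg-involutive _) θ-norm))
    α-norm (suc i) = e-norm i

    affRoot-α : ∀ i → IsAffRoot (αA i)
    affRoot-α zero    = root-neg θ θ-root
    affRoot-α (suc i) = root-e i

    affRoot-sA : ∀ i β → IsAffRoot β → IsAffRoot (sA i β)
    affRoot-sA zero    (ν , r) = root-reflQ (-Q θ) ν (root-neg θ θ-root)
    affRoot-sA (suc i) (ν , r) = root-sQ i ν

    affRoot-actA : ∀ w β → IsAffRoot β → IsAffRoot (actA w β)
    affRoot-actA []      β β-root = β-root
    affRoot-actA (i ∷ w) β β-root = affRoot-sA i (actA w β) (affRoot-actA w β β-root)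

    α-pos : ∀ i → PosAR (αA i)
    α-pos zero    = inj₁ (ℤ.+<+ (ℕ.s≤s ℕ.z≤n))
    α-pos (suc i) = inj₂ (refl , eᵢ≥0)
      where eᵢ≥0 : ∀ k → 0ℤ ≤ lookup (e i) k
            eᵢ≥0 k rewrite lookup-e i k with ⌊ i F.≟ k ⌋
            ... | true  = ℤ.+≤+ ℕ.z≤n
            ... | false = ℤ.+≤+ ℕ.z≤n

    s₀-δ : ∀ ν r → proj₂ (sA zero (ν , r)) ≡ r + pairQQ ν θ
    s₀-δ ν r = cong (_+_ r) (trans (ℤP.*-identityʳ _) (trans (cong -_ (pairQQ-negʳ θ ν)) (ℤP.neg-involutive _)))

    s₀-lookup : ∀ ν r k → lookup (proj₁ (sA zero (ν , r))) k ≡ lookup ν k + (- pairQQ ν θ) * lookup θ k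
    s₀-lookup ν r k = trans (lookup-+Q ν ((- pairQQ ν (-Q θ)) ·Q (-Q θ)) k) (cong (_+_ (lookup ν k))
      (trans (lookup-·Q (- pairQQ ν (-Q θ)) (-Q θ) k)
             (trans (cong₂ _*_ (trans (cong -_ (pairQQ-negʳ θ ν)) (ℤP.neg-involutive _)) (lookup--Q θ k)) (lem (pairQQ ν θ) (lookup θ k)))))
      where lem : ∀ t a → t * (- a) ≡ (- t) * a
            lem = solve-∀

    sᵢ-δ : ∀ i ν r → proj₂ (sA (suc i) (ν , r)) ≡ r
    sᵢ-δ i ν r = trans (cong (_+_ r) (ℤP.*-zeroʳ (- pairQQ ν (e i)))) (ℤP.+-identityʳ r)

    sQ-lookup-other : ∀ i ν j → j ≢ i → lookup (sQ i ν) j ≡ lookup ν j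
    sQ-lookup-other i ν j j≢i =
      trans (lookup-+Q ν ((- pairQQ ν (e i)) ·Q e i) j)
            (trans (cong (_+_ (lookup ν j)) (trans (lookup-·Q (- pairQQ ν (e i)) (e i) j)
                     (trans (cong ((- pairQQ ν (e i)) *_) (lookup-e-other i j j≢i)) (ℤP.*-zeroʳ (- pairQQ ν (e i))))))
                   (ℤP.+-identityʳ (lookup ν j)))

    s₀-on-−θ : ∀ r → 0ℤ < r → r ≢ 1ℤ → PosAR (sA zero (-Q θ , r))
    s₀-on-−θ (+ zero)     (ℤ.+<+ ())
    s₀-on-−θ (+ suc zero) _ r≢1 = ⊥-elim (r≢1 refl)
    s₀-on-−θ (+ suc (suc zero)) _ _ =
      inj₂ (trans (s₀-δ (-Q θ) (+ 2)) (cong (_+_ (+ 2)) ⟨−θ,θ⟩) ,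
            λ k → subst (0ℤ ≤_) (sym (trans (s₀-lookup (-Q θ) (+ 2) k)
                                            (trans (cong₂ (λ u t → u + (- t) * lookup θ k) (lookup--Q θ k) ⟨−θ,θ⟩) (lem (lookup θ k)))))
                    (θ-pos k))
      where ⟨−θ,θ⟩ : pairQQ (-Q θ) θ ≡ - (+ 2)
            ⟨−θ,θ⟩ = trans (pairQQ-negˡ θ θ) (cong -_ θ-norm)
            lem : ∀ a → (- a) + (- (- (+ 2))) * a ≡ a
            lem = solve-∀
    s₀-on-−θ (+ suc (suc (suc k))) _ _ =
      inj₁ (subst (0ℤ <_) (sym (trans (s₀-δ (-Q θ) (+ suc (suc (suc k))))
                                     (cong (_+_ (+ suc (suc (suc k)))) (trans (pairQQ-negˡ θ θ) (cong -_ θ-norm)))))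
                  (ℤ.+<+ (ℕ.s≤s ℕ.z≤n)))

    sᵢ-pos : ∀ i β → IsAffRoot β → PosAR β → β ≢ αA (suc i) → PosAR (sA (suc i) β)
    sᵢ-pos i (ν , r) _      (inj₁ r>0) _ = inj₁ (subst (0ℤ <_) (sym (sᵢ-δ i ν r)) r>0)
    sᵢ-pos i (ν , r) ν-root (inj₂ (r≡0 , ν≥0)) β≢αᵢ
      with norm2-pos⊎neg (sQ i ν) (root-norm (sQ i ν) (root-sQ i ν ν-root))
    ... | inj₁ sν≥0 = inj₂ (trans (sᵢ-δ i ν r) r≡0 , sν≥0)
    ... | inj₂ -sν≥0 = ⊥-elim (β≢αᵢ (cong₂ _,_ (norm2-supported⇒e ν i (root-norm ν ν-root) (ν≥0 i) ν₋ᵢ≡0) r≡0))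
      where
        ν₋ᵢ≡0 : ∀ j → j ≢ i → lookup ν j ≡ 0ℤ
        ν₋ᵢ≡0 j j≢i = ℤP.≤-antisym
          (subst (_≤ 0ℤ) (sQ-lookup-other i ν j j≢i) (neg-nonneg⇒nonpos (subst (0ℤ ≤_) (lookup--Q (sQ i ν) j) (-sν≥0 j))))
          (ν≥0 j)

    s₀-pos-finite : ∀ ν → PosQ ν → PosAR (sA zero (ν , 0ℤ))
    s₀-pos-finite ν ν≥0 with 0ℤ ℤP.<? pairQQ ν θ
    ... | yes t>0 = inj₁ (subst (0ℤ <_) (sym (trans (s₀-δ ν 0ℤ) (ℤP.+-identityˡ (pairQQ ν θ)))) t>0)
    ... | no t≯0 = inj₂ (trans (s₀-δ ν 0ℤ) (trans (ℤP.+-identityˡ (pairQQ ν θ)) t≡0) ,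
                         λ k → subst (0ℤ ≤_) (sym (trans (s₀-lookup ν 0ℤ k)
                                                         (trans (cong (λ t → lookup ν k + (- t) * lookup θ k) t≡0) (ℤP.+-identityʳ (lookup ν k)))))
                                 (ν≥0 k))
      where t≡0 : pairQQ ν θ ≡ 0ℤ
            t≡0 = ℤP.≤-antisym (ℤP.≮⇒≥ t≯0) (pairθ-nonneg ν ν≥0)

    s₀-pos-affine : ∀ ν r → IsRoot ν → 0ℤ < r → (ν , r) ≢ αA zero → PosAR (sA zero (ν , r))
    s₀-pos-affine ν r ν-root r>0 β≢α₀ with pairθ≥-1 ν ν-root
    ... | inj₁ refl = s₀-on-−θ r r>0 (β≢α₀ ∘ cong (-Q θ ,_))
    ... | inj₂ t≥-1 with 0ℤ ℤP.<? (r + pairQQ ν θ)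
    ...   | yes pos = inj₁ (subst (0ℤ <_) (sym (s₀-δ ν r)) pos)
    ...   | no ¬pos = inj₂ (trans (s₀-δ ν r) r+t≡0 ,
                             λ k → subst (0ℤ ≤_) (sym (trans (s₀-lookup ν r k)
                                                   (trans (cong (λ t → lookup ν k + (- t) * lookup θ k) t≡-1) (lem (lookup ν k) (lookup θ k)))))
                                     (θ+root≥0 ν ν-root k))
      where
        t = pairQQ ν θ
        -- r ≥ 1 and t ≥ −1 with r + t ≤ 0 force r = 1 and t = −1
        r+t≡0 : r + t ≡ 0ℤ
        r+t≡0 = ℤP.≤-antisym (ℤP.≮⇒≥ ¬pos) (ℤP.+-mono-≤ {+ 1} {r} { - 1ℤ} {t} (ℤP.i<j⇒suc[i]≤j r>0) t≥-1)
        t≡-1 : t ≡ - 1ℤ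
        t≡-1 = ℤP.≤-antisym
          (subst (_≤ - 1ℤ) (sym (trans (split r t) (trans (cong (_+ (- r)) r+t≡0) (ℤP.+-identityˡ (- r)))))
                 (ℤP.neg-mono-≤ (ℤP.i<j⇒suc[i]≤j r>0)))
          t≥-1
          where split : ∀ r t → t ≡ r + t + (- r)
                split = solve-∀
        lem : ∀ a b → a + (- (- 1ℤ)) * b ≡ b + a
        lem = solve-∀

    sA-pos : ∀ i β → IsAffRoot β → PosAR β → β ≢ αA i → PosAR (sA i β)
    sA-pos (suc i) β                 = sᵢ-pos i β
    sA-pos zero    (ν , r) ν-root (inj₁ r>0)        β≢α₀ = s₀-pos-affine ν r ν-root r>0 β≢α₀
    sA-pos zero    (ν , r) ν-root (inj₂ (refl , ν≥0)) _ = s₀-pos-finite ν ν≥0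

    actA-++ : ∀ u w β → actA (u ++ w) β ≡ actA u (actA w β)
    actA-++ u w β = LP.foldr-++ sA β u w

    actX-++ : ∀ u w x → actX (u ++ w) x ≡ actX u (actX w x)
    actX-++ u w x = LP.foldr-++ sX x u w

    sA-involutive : ∀ i β → sA i (sA i β) ≡ β
    sA-involutive i = Reflection.reflA-involutive (αA i) (α-norm i)

    sX-involutive : ∀ i x → sX i (sX i x) ≡ x
    sX-involutive i x = trans (sX≡reflX i (sX i x))
      (trans (cong (reflX (αA i)) (sX≡reflX i x)) (Reflection.reflX-involutive (αA i) (α-norm i) x))

    actA-inverse : ∀ w β → actA w (actA (reverse w) β) ≡ β
    actA-inverse []      β = refl
    actA-inverse (i ∷ w) β =
      trans (cong (λ z → sA i (actA w z)) (trans (cong (λ u → actA u β) (LP.unfold-reverse i w)) (actA-++ (reverse w) (i ∷ []) β)))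
            (trans (cong (sA i) (actA-inverse w (sA i β))) (sA-involutive i β))

    actX-inverse : ∀ w x → actX w (actX (reverse w) x) ≡ x
    actX-inverse []      x = refl
    actX-inverse (i ∷ w) x =
      trans (cong (λ z → sX i (actX w z)) (trans (cong (λ u → actX u x) (LP.unfold-reverse i w)) (actX-++ (reverse w) (i ∷ []) x)))
            (trans (cong (sX i) (actX-inverse w (sX i x))) (sX-involutive i x))

    actA-inverseˡ : ∀ w β → actA (reverse w) (actA w β) ≡ β
    actA-inverseˡ w β = trans (cong (λ u → actA (reverse w) (actA u β)) (sym (LP.reverse-involutive w))) (actA-inverse (reverse w) β)

    actX-inverseˡ : ∀ w x → actX (reverse w) (actX w x) ≡ x
    actX-inverseˡ w x = trans (cong (λ u → actX (reverse w) (actX u x)) (sym (LP.reverse-involutive w))) (actX-inverse (reverse w) x)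

    reflA-negA : ∀ γ β → reflA γ (negA β) ≡ negA (reflA γ β)
    reflA-negA γ β = AR-ext
      (λ k → trans (lookup-reflA γ (negA β) k)
        (trans (cong₂ (λ u v → u + (- v) * lookup (proj₁ γ) k) (lookup--Q (proj₁ β) k) (pairQQ-negˡ (proj₁ β) (proj₁ γ)))
               (trans (lem (lookup (proj₁ β) k) (pairAA β γ) (lookup (proj₁ γ) k)) (sym (trans (lookup--Q (proj₁ (reflA γ β)) k) (cong -_ (lookup-reflA γ β k)))))))
      (trans (cong (λ v → - proj₂ β + (- v) * proj₂ γ) (pairQQ-negˡ (proj₁ β) (proj₁ γ))) (lem (proj₂ β) (pairAA β γ) (proj₂ γ)))
      where lem : ∀ b p g → (- b) + (- (- p)) * g ≡ - (b + (- p) * g)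
            lem = solve-∀

    actA-negA : ∀ w β → actA w (negA β) ≡ negA (actA w β)
    actA-negA []      β = refl
    actA-negA (i ∷ w) β = trans (cong (sA i) (actA-negA w β)) (reflA-negA (αA i) (actA w β))

    sA-α : ∀ i → sA i (αA i) ≡ negA (αA i)
    sA-α i = Reflection.reflA-self (αA i) (α-norm i)

    actX-pairing : ∀ w x β → pairXA (actX w x) (actA w β) ≡ pairXA x β
    actX-pairing []      x β = refl
    actX-pairing (i ∷ w) x β = trans (cong (λ z → pairXA z (sA i (actA w β))) (sX≡reflX i (actX w x)))
      (trans (Reflection.reflX-pairing (αA i) (α-norm i) (actX w x) (actA w β)) (actX-pairing w x β))

    pairXA-actX : ∀ w x β → pairXA (actX w x) β ≡ pairXA x (actA (reverse w) β)
    pairXA-actX w x β = trans (cong (pairXA (actX w x)) (sym (actA-inverse w β))) (actX-pairing w x (actA (reverse w) β))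

    actX-conj : ∀ q γ x → actX q (reflX γ x) ≡ reflX (actA q γ) (actX q x)
    actX-conj []      γ x = refl
    actX-conj (i ∷ q) γ x = trans (cong (sX i) (actX-conj q γ x)) (trans (sX≡reflX i (reflX (actA q γ) (actX q x)))
      (trans (Conjugation.reflX-conj (αA i) (α-norm i) (actA q γ) (actX q x)) (cong (reflX (sA i (actA q γ))) (sym (sX≡reflX i (actX q x))))))

    ≈W-refl : ∀ {u} → u ≈W u
    ≈W-refl x = refl

    ≈W-trans : ∀ {u v w} → u ≈W v → v ≈W w → u ≈W w
    ≈W-trans p q x = trans (p x) (q x)

    ≈W-++ : ∀ {u u′ w w′} → u ≈W u′ → w ≈W w′ → (u ++ w) ≈W (u′ ++ w′)
    ≈W-++ {u} {u′} {w} {w′} p q x =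
      trans (actX-++ u w x) (trans (p (actX w x)) (trans (cong (actX u′) (q x)) (sym (actX-++ u′ w′ x))))

    ≈W-reverse : ∀ {u w} → u ≈W w → reverse u ≈W reverse w
    ≈W-reverse {u} {w} p y =
      trans (cong (actX (reverse u)) (trans (sym (actX-inverse w y)) (sym (p (actX (reverse w) y))))) (actX-inverseˡ u (actX (reverse w) y))

    conj-word : ∀ q j t → actA q (αA j) ≡ αA t → (q ++ j ∷ []) ≈W (t ∷ q)
    conj-word q j t eq x = trans (actX-++ q (j ∷ []) x) (trans (cong (actX q) (sX≡reflX j x))
      (trans (actX-conj q (αA j) x) (trans (cong (λ γ → reflX γ (actX q x)) eq) (sym (sX≡reflX t (actX q x))))))

    pairXA-determines : ∀ β γ → (∀ y → pairXA y β ≡ pairXA y γ) → β ≡ γ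
    pairXA-determines β γ h = AR-ext (λ k → trans (sym (coordinate β k)) (trans (h (mkX (e k) 0ℤ 0ℤ)) (coordinate γ k)))
      (trans (sym (δ-coefficient β)) (trans (h (mkX (replicate n 0ℤ) 0ℤ 1ℤ)) (δ-coefficient γ)))
      where
        coordinate : ∀ β k → pairXA (mkX (e k) 0ℤ 0ℤ) β ≡ lookup (proj₁ β) k
        coordinate β k = trans (cong₂ _+_ (pairQP-eʳ k (proj₁ β)) (ℤP.*-zeroˡ (proj₂ β))) (ℤP.+-identityʳ _)
        δ-coefficient : ∀ β → pairXA (mkX (replicate n 0ℤ) 0ℤ 1ℤ) β ≡ proj₂ β
        δ-coefficient β = trans (cong₂ _+_ (pairQP-zeroʳ (proj₁ β)) (ℤP.*-identityˡ (proj₂ β))) (ℤP.+-identityˡ _)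

    ≈W⇒actA : ∀ {u w} → u ≈W w → ∀ β → actA u β ≡ actA w β
    ≈W⇒actA {u} {w} p β = pairXA-determines (actA u β) (actA w β) λ y →
      trans (via u y) (trans (cong (λ z → pairXA z β) (≈W-reverse {u} {w} p y)) (sym (via w y)))
      where
        via : ∀ u y → pairXA y (actA u β) ≡ pairXA (actX (reverse u) y) β
        via u y = trans (cong (λ z → pairXA z (actA u β)) (sym (actX-inverse u y))) (actX-pairing u (actX (reverse u) y) β)

    -- Inversions and Coxeter length

    _≟AR_ : (β γ : AR) → Dec (β ≡ γ)
    _≟AR_ = ProdP.≡-dec (VP.≡-dec ℤ._≟_) ℤ._≟_

    actA-snoc-α : ∀ u i → actA (u ++ i ∷ []) (αA i) ≡ negA (actA u (αA i))
    actA-snoc-α u i = trans (actA-++ u (i ∷ []) (αA i)) (trans (cong (actA u) (sA-α i)) (actA-negA u (αA i)))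

    α∉Inv-snoc : ∀ u i → ¬ NegAR (actA u (αA i)) → NegAR (actA (u ++ i ∷ []) (αA i))
    α∉Inv-snoc u i ¬neg = subst NegAR (sym (actA-snoc-α u i))
      (subst PosAR (sym (negA-involutive (actA u (αA i)))) (affRoot-¬neg⇒pos _ (affRoot-actA u (αA i) (affRoot-α i)) ¬neg))

    α∈Inv-snoc : ∀ u i → NegAR (actA (u ++ i ∷ []) (αA i)) → ¬ NegAR (actA u (αA i))
    α∈Inv-snoc u i neg = affRoot-¬pos×neg _ (affRoot-actA u (αA i) (affRoot-α i))
      (subst PosAR (negA-involutive (actA u (αA i))) (subst NegAR (actA-snoc-α u i) neg))

    sA≡α⇒¬pos : ∀ i γ → sA i γ ≡ αA i → ¬ PosAR γ
    sA≡α⇒¬pos i γ eq pos = affRoot-¬pos×neg (αA i) (affRoot-α i) (α-pos i)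
      (subst PosAR (trans (sym (sA-involutive i γ)) (trans (cong (sA i) eq) (sA-α i))) pos)

    Inv-snoc⁺ : ∀ u i γ → Inv u γ → γ ≢ αA i → Inv (u ++ i ∷ []) (sA i γ)
    Inv-snoc⁺ u i γ (γ-root , pos , neg) γ≢α = affRoot-sA i γ γ-root , sA-pos i γ γ-root pos γ≢α ,
      subst NegAR (sym (trans (actA-++ u (i ∷ []) (sA i γ)) (cong (actA u) (sA-involutive i γ)))) neg

    Inv-snoc⁻ : ∀ u i β → Inv (u ++ i ∷ []) β → β ≢ αA i → Inv u (sA i β)
    Inv-snoc⁻ u i β (β-root , pos , neg) β≢α =
      affRoot-sA i β β-root , sA-pos i β β-root pos β≢α , subst NegAR (actA-++ u (i ∷ []) β) neg

    -- Inv (u s_i) = s_i (Inv u ∖ {α_i})  when  u(α_i) < 0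
    card-Inv-snoc-neg : ∀ u i {k} → Card (Inv u) k → NegAR (actA u (αA i)) →
                        Σ ℕ λ k′ → Card (Inv (u ++ i ∷ [])) k′ × suc k′ ≡ k
    card-Inv-snoc-neg u i c neg with card-split (_≟AR αA i) c
    ... | a , b , c-α , c-rest , a+b≡k =
      b , card-image (sA i) (sA i) (sA-involutive i) (sA-involutive i) to from c-rest ,
      trans (cong (ℕ._+ b) (card-unique card-singleton (card-cong only-α c-α))) a+b≡k
      where
        only-α : ∀ β → (Inv u β × β ≡ αA i → β ≡ αA i) × (β ≡ αA i → Inv u β × β ≡ αA i)
        only-α β = proj₂ , λ { refl → (affRoot-α i , α-pos i , neg) , refl }
        to : ∀ γ → Inv u γ × γ ≢ αA i → Inv (u ++ i ∷ []) (sA i γ)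
        to γ (inv , γ≢α) = Inv-snoc⁺ u i γ inv γ≢α
        from : ∀ β → Inv (u ++ i ∷ []) β → Inv u (sA i β) × sA i β ≢ αA i
        from β inv@(_ , pos , neg′) =
          Inv-snoc⁻ u i β inv (λ { refl → α∈Inv-snoc u i neg′ neg }) , λ eq → sA≡α⇒¬pos i β eq pos

    -- Inv (u s_i) = {α_i} ⊔ s_i (Inv u)  when  u(α_i) > 0
    card-Inv-snoc-pos : ∀ u i {k} → Card (Inv u) k → ¬ NegAR (actA u (αA i)) → Card (Inv (u ++ i ∷ [])) (suc k)
    card-Inv-snoc-pos u i c ¬neg =
      card-cong split (card-insert ¬shifted-α (card-image (sA i) (sA i) (sA-involutive i) (sA-involutive i) to from c))
      where
        to : ∀ γ → Inv u γ → Inv u (sA i (sA i γ))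
        to γ = subst (Inv u) (sym (sA-involutive i γ))
        from : ∀ β → Inv u (sA i β) → Inv u (sA i β)
        from β inv = inv
        ¬shifted-α : ¬ Inv u (sA i (αA i))
        ¬shifted-α (_ , pos , _) = affRoot-¬pos×neg (αA i) (affRoot-α i) (α-pos i) (subst PosAR (sA-α i) pos)
        split : ∀ β → (β ≡ αA i ⊎ Inv u (sA i β) → Inv (u ++ i ∷ []) β) × (Inv (u ++ i ∷ []) β → β ≡ αA i ⊎ Inv u (sA i β))
        split β = to′ , from′
          where
            to′ : β ≡ αA i ⊎ Inv u (sA i β) → Inv (u ++ i ∷ []) β
            to′ (inj₁ refl) = affRoot-α i , α-pos i , α∉Inv-snoc u i ¬neg
            to′ (inj₂ inv@(_ , _ , neg)) =
              subst (Inv (u ++ i ∷ [])) (sA-involutive i β)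
                (Inv-snoc⁺ u i (sA i β) inv λ sβ≡α → ¬neg (subst (λ γ → NegAR (actA u γ)) sβ≡α neg))
            from′ : Inv (u ++ i ∷ []) β → β ≡ αA i ⊎ Inv u (sA i β)
            from′ inv with β ≟AR αA i
            ... | yes β≡α = inj₁ β≡α
            ... | no β≢α  = inj₂ (Inv-snoc⁻ u i β inv β≢α)

    opaque
      card-Inv : ∀ w → Σ ℕ (Card (Inv w))
      card-Inv = snoc-induction _ (0 , card-empty λ β (β-root , pos , neg) → affRoot-¬pos×neg β β-root pos neg) step
        where
          step : ∀ u i → Σ ℕ (Card (Inv u)) → Σ ℕ (Card (Inv (u ++ i ∷ [])))
          step u i (k , c) with NegAR? (actA u (αA i))
          ... | yes neg = let (k′ , c′ , _) = card-Inv-snoc-neg u i c neg in k′ , c′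
          ... | no ¬neg = suc k , card-Inv-snoc-pos u i c ¬neg

    N : Word → ℕ
    N w = proj₁ (card-Inv w)

    N-card : ∀ w → Card (Inv w) (N w)
    N-card w = proj₂ (card-Inv w)

    N-[] : N [] ≡ 0
    N-[] = card-unique (N-card []) (card-empty λ β (β-root , pos , neg) → affRoot-¬pos×neg β β-root pos neg)

    N-≈W : ∀ {u w} → u ≈W w → N u ≡ N w
    N-≈W {u} {w} u≈w = card-unique (card-cong Inv⇔ (N-card u)) (N-card w)
      where Inv⇔ : ∀ β → (Inv u β → Inv w β) × (Inv w β → Inv u β)
            Inv⇔ β = (λ (r , p , ng) → r , p , subst NegAR (≈W⇒actA {u} {w} u≈w β) ng)
                   , (λ (r , p , ng) → r , p , subst NegAR (sym (≈W⇒actA {u} {w} u≈w β)) ng)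

    N-snoc-neg : ∀ u i → NegAR (actA u (αA i)) → suc (N (u ++ i ∷ [])) ≡ N u
    N-snoc-neg u i neg = let (k′ , c′ , eq) = card-Inv-snoc-neg u i (N-card u) neg in
      trans (cong suc (card-unique (N-card (u ++ i ∷ [])) c′)) eq

    N-snoc-pos : ∀ u i → ¬ NegAR (actA u (αA i)) → N (u ++ i ∷ []) ≡ suc (N u)
    N-snoc-pos u i ¬neg = card-unique (N-card (u ++ i ∷ [])) (card-Inv-snoc-pos u i (N-card u) ¬neg)

    length-snoc : ∀ (u : Word) i → length (u ++ i ∷ []) ≡ suc (length u)
    length-snoc u i = trans (LP.length-++ u) (ℕP.+-comm (length u) 1)

    N≤length : ∀ w → N w ℕ.≤ length w
    N≤length = snoc-induction _ (ℕP.≤-reflexive N-[]) step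
      where
        step : ∀ u i → N u ℕ.≤ length u → N (u ++ i ∷ []) ℕ.≤ length (u ++ i ∷ [])
        step u i N≤ with NegAR? (actA u (αA i))
        ... | yes neg = subst (N (u ++ i ∷ []) ℕ.≤_) (sym (length-snoc u i))
                          (ℕP.m≤n⇒m≤1+n (ℕP.≤-trans (ℕP.n≤1+n _) (subst (ℕ._≤ length u) (sym (N-snoc-neg u i neg)) N≤)))
        ... | no ¬neg = subst₂ ℕ._≤_ (sym (N-snoc-pos u i ¬neg)) (sym (length-snoc u i)) (ℕ.s≤s N≤)

    DescentFactorisation : Word → Set
    DescentFactorisation w = Σ Word λ p → Σ (Fin (suc n)) λ j → Σ Word λ s → w ≡ p ++ j ∷ s × NegAR (actA p (αA j))

    descent-factorisation : ∀ w → N w ℕ.< length w → DescentFactorisation w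
    descent-factorisation = snoc-induction _ (λ ()) step
      where
        step : ∀ u i → (N u ℕ.< length u → DescentFactorisation u) →
               N (u ++ i ∷ []) ℕ.< length (u ++ i ∷ []) → DescentFactorisation (u ++ i ∷ [])
        step u i ih N< with NegAR? (actA u (αA i))
        ... | yes neg = u , i , [] , refl , neg
        ... | no ¬neg =
          let (p , j , s , eq , neg) = ih (ℕP.≤-pred (subst₂ ℕ._<_ (N-snoc-pos u i ¬neg) (length-snoc u i) N<))
          in p , j , s ++ i ∷ [] , trans (cong (_++ i ∷ []) eq) (LP.++-assoc p (j ∷ s) (i ∷ [])) , neg

    ExchangeFactorisation : Word → Fin (suc n) → Set
    ExchangeFactorisation p j = Σ Word λ p₁ → Σ (Fin (suc n)) λ t → Σ Word λ q → p ≡ p₁ ++ t ∷ q × actA q (αA j) ≡ αA t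

    -- the last letter t at which p(α_j) turns negative must satisfy  q(α_j) = α_t  by sA-pos
    exchange-factorisation : ∀ p j → NegAR (actA p (αA j)) → ExchangeFactorisation p j
    exchange-factorisation []       j neg = ⊥-elim (affRoot-¬pos×neg (αA j) (affRoot-α j) (α-pos j) neg)
    exchange-factorisation (t ∷ p′) j neg with NegAR? (actA p′ (αA j))
    ... | yes neg′ = let (p₁ , t′ , q , eq , q-α) = exchange-factorisation p′ j neg′ in t ∷ p₁ , t′ , q , cong (t ∷_) eq , q-α
    ... | no ¬neg′ with actA p′ (αA j) ≟AR αA t
    ...   | yes p′α≡α = [] , t , p′ , refl , p′α≡α
    ...   | no p′α≢α = ⊥-elim (affRoot-¬pos×neg _ (affRoot-sA t γ γ-root) (sA-pos t γ γ-root (affRoot-¬neg⇒pos γ γ-root ¬neg′) p′α≢α) neg)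
      where γ = actA p′ (αA j)
            γ-root = affRoot-actA p′ (αA j) (affRoot-α j)

    Deletion : Word → Set
    Deletion w = Σ Word λ w′ → suc (suc (length w′)) ≡ length w × w′ ≈W w

    -- if q(α_j) = α_t, then  t q j ≈ q  (conj-word), so both letters can be dropped
    deletion-at : ∀ p₁ t q j s → actA q (αA j) ≡ αA t → Deletion ((p₁ ++ t ∷ q) ++ j ∷ s)
    deletion-at p₁ t q j s q-α = p₁ ++ q ++ s , length≡ , equiv
      where
        length≡ : suc (suc (length (p₁ ++ q ++ s))) ≡ length ((p₁ ++ t ∷ q) ++ j ∷ s)
        length≡ = trans (cong (λ z → suc (suc z)) (trans (LP.length-++ p₁) (cong (length p₁ ℕ.+_) (LP.length-++ q))))
          (sym (trans (LP.length-++ (p₁ ++ t ∷ q)) (trans (cong (ℕ._+ length (j ∷ s)) (LP.length-++ p₁))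
            (arith (length p₁) (length q) (length s)))))
          where
            arith : ∀ a b c → a ℕ.+ suc b ℕ.+ suc c ≡ suc (suc (a ℕ.+ (b ℕ.+ c)))
            arith a b c = trans (ℕP.+-suc (a ℕ.+ suc b) c) (cong suc (trans (cong (ℕ._+ c) (ℕP.+-suc a b)) (cong suc (ℕP.+-assoc a b c))))
        tqj≈q : (t ∷ q ++ j ∷ []) ≈W q
        tqj≈q x = trans (cong (sX t) (conj-word q j t q-α x)) (sX-involutive t (actX q x))
        equiv : (p₁ ++ q ++ s) ≈W ((p₁ ++ t ∷ q) ++ j ∷ s)
        equiv x = sym (trans
          (cong (λ z → actX z x) (trans (LP.++-assoc p₁ (t ∷ q) (j ∷ s)) (cong (λ z → p₁ ++ t ∷ z) (sym (LP.++-assoc q (j ∷ []) s)))))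
          (≈W-++ {p₁} {p₁} {t ∷ (q ++ j ∷ []) ++ s} {q ++ s} (≈W-refl {p₁}) (≈W-++ {t ∷ q ++ j ∷ []} {q} {s} {s} tqj≈q (≈W-refl {s})) x))

    deletion : ∀ w → N w ℕ.< length w → Deletion w
    deletion w N< =
      let (p , j , s , w≡ , neg) = descent-factorisation w N<
          (p₁ , t , q , p≡ , q-α) = exchange-factorisation p j neg
      in subst Deletion (sym (trans w≡ (cong (_++ j ∷ s) p≡))) (deletion-at p₁ t q j s q-α)

    ReducedExpression : Word → Set
    ReducedExpression w = Σ Word λ u → length u ≡ N w × u ≈W w

    reduced-expression : ∀ w → ReducedExpression w
    reduced-expression w = go (length w) w ℕP.≤-refl
      where
        go : ∀ bound w → length w ℕ.≤ bound → ReducedExpression w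
        go bound w ≤bound with ℕP.m≤n⇒m<n∨m≡n (N≤length w)
        ... | inj₂ N≡length = w , sym N≡length , ≈W-refl {w}
        go zero w ≤bound | inj₁ N< = ⊥-elim (ℕP.n≮0 (ℕP.<-≤-trans N< ≤bound))
        go (suc bound) w ≤bound | inj₁ N< =
          let (w′ , length≡ , w′≈w) = deletion w N<
              (u , length-u , u≈w′) = go bound w′ (ℕP.≤-pred (ℕP.≤-trans (ℕP.≤-trans (ℕP.n≤1+n _) (ℕP.≤-reflexive length≡)) ≤bound))
          in u , trans length-u (N-≈W {w′} {w} w′≈w) , ≈W-trans {u} {w′} {w} u≈w′ w′≈w

    N≤CoxLen : ∀ {u w} → u ≈W w → N w ℕ.≤ length u
    N≤CoxLen {u} {w} u≈w = subst (ℕ._≤ length u) (N-≈W {u} {w} u≈w) (N≤length u)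

    CoxLen-N : ∀ w → CoxLen w (N w)
    CoxLen-N w = reduced-expression w , λ u → N≤CoxLen {u} {w}

    CoxLen⇒≡N : ∀ w k → CoxLen w k → k ≡ N w
    CoxLen⇒≡N w k ((u , length-u , u≈w) , minimal) =
      let (r , length-r , r≈w) = reduced-expression w
      in ℕP.≤-antisym (subst (k ℕ.≤_) length-r (minimal r r≈w)) (subst (N w ℕ.≤_) length-u (N≤CoxLen {u} {w} u≈w))

    N-reverse≤ : ∀ w → N (reverse w) ℕ.≤ N w
    N-reverse≤ w = let (u , length-u , u≈w) = reduced-expression w in
      subst (ℕ._≤ N w) (N-≈W {reverse u} {reverse w} (≈W-reverse {u} {w} u≈w))
        (ℕP.≤-trans (N≤length (reverse u)) (ℕP.≤-reflexive (trans (LP.length-reverse u) length-u)))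

    N-reverse : ∀ w → N (reverse w) ≡ N w
    N-reverse w = ℕP.≤-antisym (N-reverse≤ w)
      (subst (λ z → N z ℕ.≤ N (reverse w)) (LP.reverse-involutive w) (N-reverse≤ (reverse w)))

    -- the last letter of a reduced expression is a descent
    descent : ∀ w → 0 ℕ.< N w → Σ (Fin (suc n)) λ j → NegAR (actA w (αA j))
    descent w N>0 with reduced-expression w
    ... | u , length-u , u≈w = go (reverseView u) length-u u≈w
      where
        go : ∀ {u} → Reverse u → length u ≡ N w → u ≈W w → Σ (Fin (suc n)) λ j → NegAR (actA w (αA j))
        go []             length-u u≈w = ⊥-elim (ℕP.<-irrefl refl (subst (0 ℕ.<_) (sym length-u) N>0))
        go (u′ ∶ _ ∶ʳ j) length-u u≈w = j , subst NegAR (≈W⇒actA {u′ ++ j ∷ []} {w} u≈w (αA j)) (α∉Inv-snoc u′ j ¬neg)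
          where
            N≡length : N (u′ ++ j ∷ []) ≡ suc (length u′)
            N≡length = trans (N-≈W {u′ ++ j ∷ []} {w} u≈w) (trans (sym length-u) (length-snoc u′ j))
            ¬neg : ¬ NegAR (actA u′ (αA j))
            ¬neg neg = ℕP.<-irrefl refl (ℕP.<-trans (ℕP.n<1+n (length u′))
              (subst (ℕ._≤ length u′) (trans (sym (N-snoc-neg u′ j neg)) (cong suc N≡length)) (N≤length u′)))

    -- The dominant chamber

    pairXA-αᵢ : ∀ ζ j → pairXA ζ (αA (suc j)) ≡ lookup (μ ζ) j
    pairXA-αᵢ ζ j = trans (cong₂ _+_ (pairQP-e j (μ ζ)) (ℤP.*-zeroʳ (l ζ))) (ℤP.+-identityʳ _)

    pairXA-α₀ : ∀ ζ → pairXA ζ (αA zero) ≡ - pairQP θ (μ ζ) + l ζ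
    pairXA-α₀ ζ = cong₂ _+_ (pairQP-negˡ θ (μ ζ)) (ℤP.*-identityʳ (l ζ))

    -- ν + rδ = r α₀ + Σⱼ (νⱼ + r θⱼ) αⱼ
    pairXA-simple-expansion : ∀ ζ ν r →
      pairXA ζ (ν , r) ≡ r * pairXA ζ (αA zero) + Σᶠ (λ j → (lookup ν j + r * lookup θ j) * pairXA ζ (αA (suc j)))
    pairXA-simple-expansion ζ ν r = sym (trans (cong₂ (λ a b → r * a + b) (pairXA-α₀ ζ)
        (trans (Σᶠ-cong λ j → trans (cong ((lookup ν j + r * lookup θ j) *_) (pairXA-αᵢ ζ j)) (lem₁ (lookup ν j) r (lookup θ j) (lookup (μ ζ) j)))
        (trans (Σᶠ-distrib-+ (λ j → lookup ν j * lookup (μ ζ) j) (λ j → r * (lookup θ j * lookup (μ ζ) j)))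
               (cong (_+_ (pairQP ν (μ ζ))) (Σᶠ-distribˡ-* r (λ j → lookup θ j * lookup (μ ζ) j))))))
      (lem₂ r (pairQP θ (μ ζ)) (l ζ) (pairQP ν (μ ζ))))
      where lem₁ : ∀ a r t m → (a + r * t) * m ≡ a * m + r * (t * m)
            lem₁ = solve-∀
            lem₂ : ∀ r T L V → r * (- T + L) + (V + r * T) ≡ V + L * r
            lem₂ = solve-∀

    pos-simple-coeff≥0 : ∀ ν r → IsRoot ν → PosAR (ν , r) → ∀ j → 0ℤ ≤ lookup ν j + r * lookup θ j
    pos-simple-coeff≥0 ν (+ suc k) ν-root (inj₁ _) j = subst (0ℤ ≤_) (lem (lookup ν j) (lookup θ j) k)
        (ℤP.+-mono-≤ (subst (0ℤ ≤_) (ℤP.+-comm (lookup θ j) (lookup ν j)) (θ+root≥0 ν ν-root j)) (*-nonneg {+ k} (ℤ.+≤+ ℕ.z≤n) (θ-pos j)))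
      where lem : ∀ a t k → a + t + (+ k) * t ≡ a + (+ suc k) * t
            lem a t k = trans (ℤP.+-assoc a t (+ k * t)) (cong (_+_ a) (sym (trans (ℤP.*-distribʳ-+ t (+ 1) (+ k)) (cong (_+ (+ k * t)) (ℤP.*-identityˡ t)))))
    pos-simple-coeff≥0 ν (+ zero) ν-root (inj₁ (ℤ.+<+ ())) j
    pos-simple-coeff≥0 ν .0ℤ ν-root (inj₂ (refl , ν≥0)) j =
      subst (0ℤ ≤_) (sym (trans (cong (_+_ (lookup ν j)) (ℤP.*-zeroˡ (lookup θ j))) (ℤP.+-identityʳ _))) (ν≥0 j)

    dominant-pos≥0 : ∀ ζ β → Dominant ζ → IsAffRoot β → PosAR β → 0ℤ ≤ pairXA ζ β
    dominant-pos≥0 ζ (ν , r) dom ν-root pos = subst (0ℤ ≤_) (sym (pairXA-simple-expansion ζ ν r))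
      (ℤP.+-mono-≤ (*-nonneg (r≥0 pos) (dom zero)) (Σᶠ-nonneg _ λ j → *-nonneg (pos-simple-coeff≥0 ν r ν-root pos j) (dom (suc j))))
      where r≥0 : PosAR (ν , r) → 0ℤ ≤ r
            r≥0 (inj₁ r>0)       = ℤP.<⇒≤ r>0
            r≥0 (inj₂ (refl , _)) = ℤP.≤-refl

    regular-pos>0 : ∀ ζ β → Regular ζ → IsAffRoot β → PosAR β → 0ℤ < pairXA ζ β
    regular-pos>0 ζ (ν , r) reg ν-root (inj₁ r>0) = subst (0ℤ <_) (sym (pairXA-simple-expansion ζ ν r))
      (ℤP.+-mono-<-≤ (*-pos r>0 (reg zero))
                     (Σᶠ-nonneg _ λ j → *-nonneg (pos-simple-coeff≥0 ν r ν-root (inj₁ r>0) j) (ℤP.<⇒≤ (reg (suc j)))))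
    regular-pos>0 ζ (ν , .0ℤ) reg ν-root (inj₂ (refl , ν≥0)) with FP.any? (λ j → 0ℤ ℤP.<? lookup ν j)
    ... | yes (j , νⱼ>0) = subst (0ℤ <_) (sym (pairXA-simple-expansion ζ ν 0ℤ))
          (ℤP.+-mono-≤-< (ℤP.≤-reflexive (sym (ℤP.*-zeroˡ (pairXA ζ (αA zero)))))
            (Σᶠ-pos _ (λ i → *-nonneg (pos-simple-coeff≥0 ν 0ℤ ν-root (inj₂ (refl , ν≥0)) i) (ℤP.<⇒≤ (reg (suc i)))) j
              (*-pos (subst (0ℤ <_) (sym (trans (cong (_+_ (lookup ν j)) (ℤP.*-zeroˡ (lookup θ j))) (ℤP.+-identityʳ _))) νⱼ>0) (reg (suc j)))))
    ... | no ∄νⱼ>0 = ⊥-elim (norm2-nonzero ν (root-norm ν ν-root) λ k → ℤP.≤-antisym (ℤP.≮⇒≥ (λ νₖ>0 → ∄νⱼ>0 (k , νₖ>0))) (ν≥0 k))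

    dominant-neg≤0 : ∀ ζ β → Dominant ζ → IsAffRoot β → NegAR β → pairXA ζ β ≤ 0ℤ
    dominant-neg≤0 ζ β dom β-root neg =
      neg-nonneg⇒nonpos (subst (0ℤ ≤_) (pairXA-negʳ ζ β) (dominant-pos≥0 ζ (negA β) dom (affRoot-negA β β-root) neg))

    regular-neg<0 : ∀ ζ β → Regular ζ → IsAffRoot β → NegAR β → pairXA ζ β < 0ℤ
    regular-neg<0 ζ β reg β-root neg = subst (_< 0ℤ) (ℤP.neg-involutive _)
      (ℤP.neg-mono-< (subst (0ℤ <_) (pairXA-negʳ ζ β) (regular-pos>0 ζ (negA β) reg (affRoot-negA β β-root) neg)))

    sX-fixes : ∀ j x → pairXA x (αA j) ≡ 0ℤ → sX j x ≡ x
    sX-fixes j x ⟨x,α⟩≡0 = trans (cong (λ c → x +X ((- c) ·X αX j)) ⟨x,α⟩≡0) (X-ext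
      (λ k → trans (lookup-+Q (μ x) _ k) (trans (cong (_+_ (lookup (μ x) k)) (lookup-·Q (- 0ℤ) (μ (αX j)) k)) (ℤP.+-identityʳ _)))
      (trans (cong (_+_ (m x)) (ℤP.*-zeroˡ (m (αX j)))) (ℤP.+-identityʳ (m x)))
      (trans (cong (_+_ (l x)) (ℤP.*-zeroˡ (l (αX j)))) (ℤP.+-identityʳ (l x))))

    -- a dominant ζ is the only dominant element of its orbit: peel off descents of u⁻¹,
    -- each of which fixes u ζ because ⟨u ζ, α_j⟩ is both ≥ 0 and ≤ 0
    dominant-unique : ∀ k u ζ → Dominant ζ → N (reverse u) ≡ k → Dominant (actX u ζ) → actX u ζ ≡ ζ
    dominant-unique zero u ζ dom N≡0 dom-uζ =
      let (r , length-r , r≈u⁻¹) = reduced-expression (reverse u) in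
      trans (sym (trans (sym (r≈u⁻¹ (actX u ζ))) (cong (λ z → actX z (actX u ζ)) (length≡0⇒≡[] r (trans length-r N≡0)))))
            (actX-inverseˡ u ζ)
    dominant-unique (suc k) u ζ dom N≡suc dom-uζ =
      let (j , neg) = descent (reverse u) (subst (0 ℕ.<_) (sym N≡suc) (ℕ.s≤s ℕ.z≤n))
          γ = actA (reverse u) (αA j)
          ⟨uζ,α⟩≡0 : pairXA (actX u ζ) (αA j) ≡ 0ℤ
          ⟨uζ,α⟩≡0 = ℤP.≤-antisym (subst (_≤ 0ℤ) (sym (pairXA-actX u ζ (αA j))) (dominant-neg≤0 ζ γ dom (affRoot-actA (reverse u) (αA j) (affRoot-α j)) neg))
                                   (dom-uζ j)
          fixed : actX (j ∷ u) ζ ≡ actX u ζ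
          fixed = sX-fixes j (actX u ζ) ⟨uζ,α⟩≡0
          N≡k : N (reverse (j ∷ u)) ≡ k
          N≡k = ℕP.suc-injective (trans (cong (λ z → suc (N z)) (LP.unfold-reverse j u)) (trans (N-snoc-neg (reverse u) j neg) N≡suc))
      in trans (sym fixed) (dominant-unique k (j ∷ u) ζ dom N≡k (subst Dominant (sym fixed) dom-uζ))

    dominant-orbit-unique : ∀ u ζ ζ₊ → Dominant ζ → Dominant ζ₊ → actX u ζ ≡ ζ₊ → ζ₊ ≡ ζ
    dominant-orbit-unique u ζ ζ₊ dom dom₊ uζ≡ζ₊ =
      trans (sym uζ≡ζ₊) (dominant-unique (N (reverse u)) u ζ dom refl (subst Dominant (sym uζ≡ζ₊) dom₊))

    InvNonpos InvPos : X → Word → AR → Set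
    InvNonpos x w β = Inv (inv w) β × pairXA x β ≤ 0ℤ
    InvPos    x w β = Inv (inv w) β × 0ℤ < pairXA x β

    -- For regular ζ the sign of ⟨vζ, β⟩ = ⟨ζ, v⁻¹β⟩ is the sign of the root v⁻¹β.
    module _ (ζ : X) (reg : Regular ζ) (v w : Word) where

      private
        v⁻¹-root : ∀ β → IsAffRoot β → IsAffRoot (actA (reverse v) β)
        v⁻¹-root = affRoot-actA (reverse v)

        actA-w⁻¹v : ∀ γ → actA (reverse w ++ v) γ ≡ actA (reverse w) (actA v γ)
        actA-w⁻¹v = actA-++ (reverse w) v

      InvNonpos⇔ : ∀ β → (InvNonpos (actX v ζ) w β → Inv (reverse v) β × NegAR (actA (reverse w) β))
                       × (Inv (reverse v) β × NegAR (actA (reverse w) β) → InvNonpos (actX v ζ) w β)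
      InvNonpos⇔ β = to , from
        where
          to : InvNonpos (actX v ζ) w β → Inv (reverse v) β × NegAR (actA (reverse w) β)
          to ((β-root , pos , w⁻¹β<0) , ≤0) = (β-root , pos , affRoot-¬pos⇒neg _ (v⁻¹-root β β-root) λ v⁻¹β>0 →
            ℤP.<-irrefl refl (ℤP.<-≤-trans (regular-pos>0 ζ _ reg (v⁻¹-root β β-root) v⁻¹β>0) (subst (_≤ 0ℤ) (pairXA-actX v ζ β) ≤0))) , w⁻¹β<0
          from : Inv (reverse v) β × NegAR (actA (reverse w) β) → InvNonpos (actX v ζ) w β
          from ((β-root , pos , v⁻¹β<0) , w⁻¹β<0) =
            (β-root , pos , w⁻¹β<0) , subst (_≤ 0ℤ) (sym (pairXA-actX v ζ β)) (ℤP.<⇒≤ (regular-neg<0 ζ _ reg (v⁻¹-root β β-root) v⁻¹β<0))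

      InvPos≅ : ∀ {b} → Card (λ γ → Inv (reverse w ++ v) γ × PosAR (actA v γ)) b → Card (InvPos (actX v ζ) w) b
      InvPos≅ = card-image (actA v) (actA (reverse v)) (actA-inverseˡ v) (actA-inverse v) to from
        where
          to : ∀ γ → Inv (reverse w ++ v) γ × PosAR (actA v γ) → InvPos (actX v ζ) w (actA v γ)
          to γ ((γ-root , pos , neg) , vγ>0) =
            (affRoot-actA v γ γ-root , vγ>0 , subst NegAR (actA-w⁻¹v γ) neg) ,
            subst (0ℤ <_) (sym (trans (pairXA-actX v ζ (actA v γ)) (cong (pairXA ζ) (actA-inverseˡ v γ)))) (regular-pos>0 ζ γ reg γ-root pos)
          from : ∀ β → InvPos (actX v ζ) w β → Inv (reverse w ++ v) (actA (reverse v) β) × PosAR (actA v (actA (reverse v) β))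
          from β ((β-root , pos , neg) , >0) =
            (v⁻¹-root β β-root , v⁻¹β>0 , subst NegAR (sym (trans (actA-w⁻¹v _) (cong (actA (reverse w)) (actA-inverse v β)))) neg) ,
            subst PosAR (sym (actA-inverse v β)) pos
            where
              v⁻¹β>0 : PosAR (actA (reverse v) β)
              v⁻¹β>0 = affRoot-¬neg⇒pos _ (v⁻¹-root β β-root) λ v⁻¹β<0 →
                ℤP.<-asym (subst (0ℤ <_) (pairXA-actX v ζ β) >0) (regular-neg<0 ζ _ reg (v⁻¹-root β β-root) v⁻¹β<0)

      -- the inversions of v⁻¹ not inverted by w⁻¹ match those of w⁻¹v sent to negative roots by v, via γ ↦ −vγ
      remaining≅ : ∀ {d} → Card (λ γ → Inv (reverse w ++ v) γ × ¬ PosAR (actA v γ)) d →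
                   Card (λ β → Inv (reverse v) β × ¬ NegAR (actA (reverse w) β)) d
      remaining≅ = card-image (λ γ → negA (actA v γ)) (λ β → actA (reverse v) (negA β))
        (λ γ → trans (cong (actA (reverse v)) (negA-involutive (actA v γ))) (actA-inverseˡ v γ))
        (λ β → trans (cong negA (actA-inverse v (negA β))) (negA-involutive β))
        to from
        where
          to : ∀ γ → Inv (reverse w ++ v) γ × ¬ PosAR (actA v γ) → Inv (reverse v) (negA (actA v γ)) × ¬ NegAR (actA (reverse w) (negA (actA v γ)))
          to γ ((γ-root , pos , neg) , ¬vγ>0) =
            (affRoot-negA (actA v γ) vγ-root , affRoot-¬pos⇒neg (actA v γ) vγ-root ¬vγ>0 ,
             subst NegAR (sym (trans (actA-negA (reverse v) (actA v γ)) (cong negA (actA-inverseˡ v γ)))) (subst PosAR (sym (negA-involutive γ)) pos)) ,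
            λ neg′ → affRoot-¬pos×neg _ (affRoot-actA (reverse w) _ vγ-root)
              (subst PosAR (negA-involutive (actA (reverse w) (actA v γ))) (subst NegAR (actA-negA (reverse w) (actA v γ)) neg′)) (subst NegAR (actA-w⁻¹v γ) neg)
            where vγ-root = affRoot-actA v γ γ-root
          from : ∀ β → Inv (reverse v) β × ¬ NegAR (actA (reverse w) β) →
                 Inv (reverse w ++ v) (actA (reverse v) (negA β)) × ¬ PosAR (actA v (actA (reverse v) (negA β)))
          from β ((β-root , pos , v⁻¹β<0) , ¬w⁻¹β<0) =
            (v⁻¹-root _ (affRoot-negA β β-root) , subst PosAR (sym (actA-negA (reverse v) β)) v⁻¹β<0 ,
             subst NegAR (sym (trans (actA-w⁻¹v _) (trans (cong (actA (reverse w)) (actA-inverse v (negA β))) (actA-negA (reverse w) β))))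
                   (subst PosAR (sym (negA-involutive (actA (reverse w) β))) (affRoot-¬neg⇒pos _ (affRoot-actA (reverse w) β β-root) ¬w⁻¹β<0))) ,
            λ pos′ → affRoot-¬pos×neg β β-root pos (subst PosAR (actA-inverse v (negA β)) pos′)

      -- |Inv(v⁻¹)| = a + d  and  |Inv(w⁻¹v)| = b + d, where d counts the inversions common to the two splittings
      inversion-count : ∀ {a b} → Card (InvNonpos (actX v ζ) w) a → Card (InvPos (actX v ζ) w) b →
                        a ℕ.+ N (reverse w ++ v) ≡ b ℕ.+ N (reverse v)
      inversion-count {a} {b} c-nonpos c-pos
        with card-split (NegAR? ∘ actA (reverse w)) (N-card (reverse v))
           | card-split (PosAR? ∘ actA v) (N-card (reverse w ++ v))
      ... | a₁ , d₁ , c-a₁ , c-d₁ , a₁+d₁ | b₂ , d₂ , c-b₂ , c-d₂ , b₂+d₂ = begin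
        a ℕ.+ N (reverse w ++ v)    ≡⟨ cong (a ℕ.+_) b₂+d₂ ⟨
        a ℕ.+ (b₂ ℕ.+ d₂)           ≡⟨ cong₂ (λ x y → x ℕ.+ y) a≡a₁ (cong₂ ℕ._+_ b₂≡b d₂≡d₁) ⟩
        a₁ ℕ.+ (b ℕ.+ d₁)           ≡⟨ x∙yz≈y∙xz a₁ b d₁ ⟩
        b ℕ.+ (a₁ ℕ.+ d₁)           ≡⟨ cong (b ℕ.+_) a₁+d₁ ⟩
        b ℕ.+ N (reverse v)         ∎
        where
          open ≡-Reasoning
          a≡a₁ : a ≡ a₁
          a≡a₁ = card-unique (card-cong InvNonpos⇔ c-nonpos) c-a₁
          b₂≡b : b₂ ≡ b
          b₂≡b = card-unique (InvPos≅ c-b₂) c-pos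
          d₂≡d₁ : d₂ ≡ d₁
          d₂≡d₁ = card-unique (remaining≅ c-d₂) c-d₁

      card-InvNonpos×InvPos : Σ ℕ λ a → Σ ℕ λ b → Card (InvNonpos (actX v ζ) w) a × Card (InvPos (actX v ζ) w) b
      card-InvNonpos×InvPos with card-split (λ β → pairXA (actX v ζ) β ℤP.≤? 0ℤ) (N-card (reverse w))
      ... | a , b , c-nonpos , c-¬nonpos , _ =
        a , b , c-nonpos , card-cong (λ β → (λ (inv , ≰) → inv , ℤP.≰⇒> ≰) , (λ (inv , >0) → inv , ℤP.<⇒≱ >0)) c-¬nonpos

    N-reverse-swap : ∀ v w → N (reverse v ++ w) ≡ N (reverse w ++ v)
    N-reverse-swap v w = trans (cong N (sym (trans (LP.reverse-++ (reverse w) v) (cong (reverse v ++_) (LP.reverse-involutive w)))))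
                               (N-reverse (reverse w ++ v))

    LenW-formula : ∀ f ζ → Regular ζ → ∀ v w {L} → LenW f (actX v ζ) w L →
                   L ≡ two ℚ.* f ζ ℚ.+ ℕtoℚ (N v) ℚ.- ℕtoℚ (N (reverse w ++ v))
    LenW-formula f ζ reg v w (ζ₊ , dom₊ , (u , uvζ≡ζ₊) , a , b , c-nonpos , c-pos , L≡) =
      trans L≡ (trans (cong (λ z → two ℚ.* f z ℚ.+ ℕtoℚ a ℚ.- ℕtoℚ b) ζ₊≡ζ)
                      (ℚ-balance (two ℚ.* f ζ) {a} {b} {N v} {N (reverse w ++ v)} count))
      where count : a ℕ.+ N (reverse w ++ v) ≡ b ℕ.+ N v
            count = trans (inversion-count ζ reg v w c-nonpos c-pos) (cong (b ℕ.+_) (N-reverse v))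
            ζ₊≡ζ : ζ₊ ≡ ζ
            ζ₊≡ζ = dominant-orbit-unique (u ++ v) ζ ζ₊ (ℤP.<⇒≤ ∘ reg) dom₊ (trans (actX-++ u v ζ) uvζ≡ζ₊)

    LenW-defined : ∀ f ζ → Regular ζ → ∀ v w → Σ ℚ (LenW f (actX v ζ) w)
    LenW-defined f ζ reg v w =
      let (a , b , c-nonpos , c-pos) = card-InvNonpos×InvPos ζ reg v w in
      _ , ζ , ℤP.<⇒≤ ∘ reg , (reverse v , actX-inverseˡ v ζ) , a , b , c-nonpos , c-pos , refl

open import Data.Rational using (ℚ; _+_; _-_; _*_)

mainTheorem4 : (C : SLCartan) (θ : Vec ℤ (SLCartan.n C)) →
    let open Affine C θ in
    IsHighestRoot θ →
    (f : X → ℚ) → IsRho f →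
    (ζ : X) → InTits ζ → Regular ζ →
    (v w : Word) →
    ((L L₀ : ℚ) (a b c : ℕ) →
      LenW f (actX v ζ) w L → LenW f ζ [] L₀ →
      CoxLen (inv v ++ w) a → CoxLen v b → CoxLen (inv w ++ v) c →
      (L ≡ L₀ - ℕtoℚ a + ℕtoℚ b) ×
      (L₀ - ℕtoℚ a + ℕtoℚ b ≡ two * f ζ - ℕtoℚ c + ℕtoℚ b))
    ×
    (Σ ℚ λ L → Σ ℚ λ L₀ → ∃ λ a → ∃ λ b → ∃ λ c →
      LenW f (actX v ζ) w L × LenW f ζ [] L₀ ×
      CoxLen (inv v ++ w) a × CoxLen v b × CoxLen (inv w ++ v) c)
mainTheorem4 C θ hθ f _ ζ _ reg v w =
  (λ L L₀ a b c len len₀ ℓa ℓb ℓc →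
    ℚ-length-identities (two * f ζ) (LenW-formula f ζ reg v w len) (LenW-formula f ζ reg [] [] len₀)
      (cong ℕtoℚ (trans (CoxLen⇒≡N (inv v ++ w) a ℓa) (N-reverse-swap v w)))
      (cong ℕtoℚ (CoxLen⇒≡N v b ℓb)) (cong ℕtoℚ (CoxLen⇒≡N (inv w ++ v) c ℓc))) ,
  (_ , _ , _ , _ , _ , proj₂ (LenW-defined f ζ reg v w) , proj₂ (LenW-defined f ζ reg [] []) ,
   CoxLen-N (inv v ++ w) , CoxLen-N v , CoxLen-N (inv w ++ v))
  where
    open Affine C θ
    open AffineRootSystem C θ
    open HighestRoot hθ
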